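{- Let $q>1$ and $b\ge1$. The distribution $\widetilde\tau\mapsto(1-q^{ -1})^b\,q^{ -\ell(\widetilde\tau)}$ on the set of $b$-ball flag juggling states is a stationary distribution of the backward flag juggling Markov chain with coin parameter $q$.
   Context: A $b$-ball flag juggling state is a word indexed by positions $0,1,2,\dots$ in which each number $1,\dots,b$ occurs exactly once and all other positions carry $-$. $\ell(\widetilde\tau)$ is the number of pairs of positions $i<j$ such that the entry at $i$ is strictly greater than the entry at $j$, with $-$ treated as $+\infty$ (pairs of two $-$s not counted). Backward flag juggling Markov chain (coin with probability of heads $1/q$, $-$ treated as $+\infty$ when comparing): (1) hold a $-$ and point at the rightmost number of the state; (2) flip the coin: if tails, put down what is held at the pointed position and pick up the number that was there; if heads, do nothing; (3) move leftwards from the current position, stopping at the first number strictly smaller than what is held; (4) if such a number is met, go back to (2) pointing at it; otherwise, having passed the left end, place the held item in a new position at the front of the word (all existing positions shift up by one); the result is the new state.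
   Formalization: The coin parameter q ranges over the rationals with $q>1$. -}

module Defs where

open import Data.Nat as ℕ using (ℕ; zero; suc; _∸_)
open import Data.Bool using (Bool; true; false; if_then_else_; _∧_)
open import Data.List using (List; []; _∷_; length; map; _++_; filter; foldr; concatMap)
open import Data.Product using (_×_; _,_; proj₁; proj₂; Σ; ∃)
open import Data.Rational as ℚ using (ℚ; 0ℚ; 1ℚ; _+_; _*_; _-_; ∣_∣; _<_)
open import Relation.Nullary using (Dec; yes; no; does)
open import Relation.Binary.PropositionalEquality using (_≡_; refl; cong)
import Data.List.Properties as LP

data Entry : Set where
  num  : ℕ → Entry
  dash : Entry

-- Words are finite lists; the infinite word is this list followed by
-- infinitely many dashes.  Position i of the word is index i of the list.
Word : Set
Word = List Entry

num-inj : ∀ {a b} → num a ≡ num b → a ≡ b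
num-inj refl = refl

_≟E_ : (x y : Entry) → Dec (x ≡ y)
num a ≟E num b with a ℕ.≟ b
... | yes refl = yes refl
... | no  a≢b  = no (λ e → a≢b (num-inj e))
num a ≟E dash = no (λ ())
dash ≟E num b = no (λ ())
dash ≟E dash = yes refl

_≟W_ : (x y : Word) → Dec (x ≡ y)
_≟W_ = LP.≡-dec _≟E_

isDash : Entry → Bool
isDash dash = true
isDash (num _) = false

-- remove trailing dashes (canonical finite representative)
trim : Word → Word
trim [] = []
trim (x ∷ xs) with trim xs
... | [] = if isDash x then [] else x ∷ []
... | y ∷ ys = x ∷ y ∷ ys

-- strict comparison with "-" treated as +∞
ltE : Entry → Entry → Bool
ltE (num a) (num b) = a ℕ.<ᵇ b
ltE (num a) dash    = true
ltE dash    _       = false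

-- entry strictly greater, pairs of two dashes not counted
gtE : Entry → Entry → Bool
gtE x y = ltE y x

countB : {A : Set} → (A → Bool) → List A → ℕ
countB p [] = 0
countB p (x ∷ xs) = if p x then suc (countB p xs) else countB p xs

-- ℓ : number of pairs i < j with entry i strictly greater than entry j
inversions : Word → ℕ
inversions [] = 0
inversions (x ∷ xs) = countB (gtE x) xs ℕ.+ inversions xs

occ : ℕ → Word → ℕ
occ k = countB (λ e → does (e ≟E num k))

inRange : ℕ → Entry → Bool
inRange b dash = true
inRange b (num k) = (1 ℕ.≤ᵇ k) ∧ (k ℕ.≤ᵇ b)

upTo1 : ℕ → List ℕ
upTo1 zero = []
upTo1 (suc b) = upTo1 b ++ (suc b ∷ [])

allB : {A : Set} → (A → Bool) → List A → Bool
allB p [] = true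
allB p (x ∷ xs) = p x ∧ allB p xs

validB : ℕ → Word → Bool
validB b w = allB (inRange b) w ∧ allB (λ k → occ k w ℕ.≡ᵇ 1) (upTo1 b)

IsState : ℕ → Word → Set
IsState b w = (validB b w ≡ true) × (trim w ≡ w)

allWords : ℕ → ℕ → List Word
allWords b zero = [] ∷ []
allWords b (suc N) = concatMap (λ w → map (λ e → e ∷ w) (dash ∷ map num (upTo1 b))) (allWords b N)

statesIn : ℕ → ℕ → List Word
statesIn b N = map trim (filter (λ w → validB b w Data.Bool.≟ true) (allWords b N))

-- list access / update (out-of-range reads give "-")
get : Word → ℕ → Entry
get [] _ = dash
get (x ∷ xs) zero = x
get (x ∷ xs) (suc k) = get xs k

setAt : Word → ℕ → Entry → Word
setAt [] _ e = []
setAt (x ∷ xs) zero e = e ∷ xs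
setAt (x ∷ xs) (suc k) e = x ∷ setAt xs k e

-- Backward flag juggling chain, h = probability of heads (= 1/q).
-- Outcomes: list of (probability of this branch, resulting word).
module Chain (h : ℚ) where
  scale : ℚ → ℚ × Word → ℚ × Word
  scale c (p , w) = (c * p , w)

  mutual
    -- step (2): pointing at position k, holding `held`
    flipAt : ℕ → Entry → Word → List (ℚ × Word)
    flipAt k held w =
      map (scale h) (scan k held w) ++
      map (scale (1ℚ - h)) (scan k (get w k) (setAt w k held))

    -- step (3)/(4): scan positions k-1, k-2, …, 0 for the first number
    -- strictly smaller than held; if none, put held at a new front position
    scan : ℕ → Entry → Word → List (ℚ × Word)
    scan zero held w = (1ℚ , held ∷ w) ∷ []
    scan (suc k) held w =
      if ltE (get w k) held then flipAt k held w else scan k held w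

  -- step (1): hold - and point at the rightmost number
  outcomes : Word → List (ℚ × Word)
  outcomes τ = flipAt (length (trim τ) ∸ 1) dash (trim τ)

sumℚ : List ℚ → ℚ
sumℚ = foldr _+_ 0ℚ

trans : ℚ → Word → Word → ℚ
trans h τ σ = sumℚ (map proj₁ (filter (λ o → trim (proj₂ o) ≟W σ) (Chain.outcomes h τ)))

powℚ : ℚ → ℕ → ℚ
powℚ x zero = 1ℚ
powℚ x (suc n) = x * powℚ x n

piDist : ℚ → ℕ → Word → ℚ
piDist h b τ = powℚ (1ℚ - h) b * powℚ h (inversions τ)

Converges : (ℕ → ℚ) → ℚ → Set
Converges s L = ∀ (ε : ℚ) → 0ℚ < ε → ∃ λ N₀ → ∀ N → N₀ ℕ.≤ N → ∣ s N - L ∣ < ε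

-- Read a state from right to left and let h = 1/q.  The backward chain is then a scan that
-- carries one symbol and, at every entry smaller than it, either keeps carrying it (heads,
-- probability h) or swaps it for that entry (tails, probability 1 − h); at the end the carried
-- symbol is put in front.  Let the scan start while carrying an arbitrary symbol x instead of −.
-- For this enlarged kernel h^ℓ is exactly stationary: the first emitted letter c arises either by
-- passing over c or by swapping the carried letter for c, and the weights of the two preimages,
-- multiplied by h and 1 − h, add up to the weight of the output.  The chain itself is the part of
-- the kernel that starts with −, so on the states inside the window [0, N) the defect of π·P
-- against π is the mass of scans started on a number.  That is at most the mass of the states
-- with a ball at position N, i.e. Z(N+1) − Z(N) for the partition sum Z(N) of h^ℓ.  Inserting the
-- largest ball into a free slot gives Z(N) = ∏_{i<b} (1 + h + ⋯ + h^{N−i−1}), hence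
-- (1 − h)^b Z(N) = ∏_{i<b} (1 − h^{N−i}) → 1.
module Submission where

open import Defs
open import Data.Bool using (Bool; true; false; if_then_else_; _∧_; not)
open import Data.Bool using () renaming (_≟_ to _≟B_)
open import Data.Empty using (⊥-elim)
open import Data.List using (List; []; _∷_; _++_; length; map; reverse; replicate; filter; concatMap; take; drop)
import Data.List.Properties as LP
open import Data.List.Membership.Propositional using (_∈_)
open import Data.List.Membership.Propositional.Properties using (∈-++⁺ˡ; ∈-++⁺ʳ; ∈-++⁻)
open import Data.List.Relation.Unary.All using (All; []; _∷_)
open import Data.List.Relation.Unary.Any using (here; there)
open import Data.List.Relation.Binary.Permutation.Propositional as Perm using (_↭_)
open import Data.List.Relation.Binary.Permutation.Propositional.Properties using (↭-reverse)
open import Data.Nat as N using (ℕ; zero; suc; z≤n; s≤s; _≤_)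
import Data.Nat.Properties as NP
import Data.Nat.Solver as NS
import Algebra.Properties.CommutativeSemigroup NP.+-commutativeSemigroup as ℕ+
import Data.Nat.Coprimality as Cop
import Data.Integer as ℤ
open import Data.Integer using (+[1+_]) renaming (+_ to ℤ+_)
import Data.Integer.Properties as ZP
open import Data.Product using (_×_; Σ; _,_; proj₁; proj₂)
open import Data.Rational as Q using (ℚ; 0ℚ; 1ℚ; _+_; _-_; -_; _*_; _<_; NonZero; 1/_; mkℚ; *≤*; *<*)
open import Data.Rational using () renaming (_≤_ to _≤q_)
import Data.Rational.Properties as QP
open import Data.Rational.Solver using (module +-*-Solver)
open import Data.Sum using (_⊎_; inj₁; inj₂)
open import Relation.Binary.PropositionalEquality using (_≡_; _≢_; refl; sym; cong; cong₂; subst; module ≡-Reasoning)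
  renaming (trans to ≡-trans)
open import Relation.Nullary using (Dec; yes; no; does)

-- Finite sums and counting over lists

sumL : {A : Set} → List A → (A → ℚ) → ℚ
sumL [] f = 0ℚ
sumL (x ∷ xs) f = f x + sumL xs f

sumℚ-map : {A : Set} (xs : List A) (f : A → ℚ) → sumℚ (map f xs) ≡ sumL xs f
sumℚ-map [] f = refl
sumℚ-map (x ∷ xs) f = cong (f x +_) (sumℚ-map xs f)

sumL-cong : {A : Set} (xs : List A) {f g : A → ℚ} → (∀ x → f x ≡ g x) → sumL xs f ≡ sumL xs g
sumL-cong [] e = refl
sumL-cong (x ∷ xs) e = cong₂ _+_ (e x) (sumL-cong xs e)

sumL-+ : {A : Set} (xs : List A) (f g : A → ℚ) → sumL xs (λ x → f x + g x) ≡ sumL xs f + sumL xs g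
sumL-+ [] f g = refl
sumL-+ (x ∷ xs) f g = ≡-trans (cong (f x + g x +_) (sumL-+ xs f g)) (interchange (f x) (g x) (sumL xs f) (sumL xs g))
  where
  open +-*-Solver
  interchange : ∀ a b c d → (a + b) + (c + d) ≡ (a + c) + (b + d)
  interchange = solve 4 (λ a b c d → (a :+ b) :+ (c :+ d) := (a :+ c) :+ (b :+ d)) refl

sumL-*ˡ : {A : Set} (xs : List A) (c : ℚ) (f : A → ℚ) → sumL xs (λ x → c * f x) ≡ c * sumL xs f
sumL-*ˡ [] c f = sym (QP.*-zeroʳ c)
sumL-*ˡ (x ∷ xs) c f = ≡-trans (cong (c * f x +_) (sumL-*ˡ xs c f)) (sym (QP.*-distribˡ-+ c (f x) (sumL xs f)))

sumL-*ʳ : {A : Set} (xs : List A) (c : ℚ) (f : A → ℚ) → sumL xs (λ x → f x * c) ≡ sumL xs f * c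
sumL-*ʳ xs c f = ≡-trans (sumL-cong xs (λ x → QP.*-comm (f x) c)) (≡-trans (sumL-*ˡ xs c f) (QP.*-comm c (sumL xs f)))

sumL-zero : {A : Set} (xs : List A) → sumL xs (λ _ → 0ℚ) ≡ 0ℚ
sumL-zero [] = refl
sumL-zero (x ∷ xs) = ≡-trans (cong (0ℚ +_) (sumL-zero xs)) refl

sumL-++ : {A : Set} (xs ys : List A) (f : A → ℚ) → sumL (xs ++ ys) f ≡ sumL xs f + sumL ys f
sumL-++ [] ys f = sym (QP.+-identityˡ _)
sumL-++ (x ∷ xs) ys f = ≡-trans (cong (f x +_) (sumL-++ xs ys f)) (sym (QP.+-assoc (f x) (sumL xs f) (sumL ys f)))

sumL-map : {A B : Set} (xs : List A) (g : A → B) (f : B → ℚ) → sumL (map g xs) f ≡ sumL xs (λ x → f (g x))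
sumL-map [] g f = refl
sumL-map (x ∷ xs) g f = cong (f (g x) +_) (sumL-map xs g f)

sumL-concatMap : {A B : Set} (xs : List A) (g : A → List B) (f : B → ℚ) →
  sumL (concatMap g xs) f ≡ sumL xs (λ x → sumL (g x) f)
sumL-concatMap [] g f = refl
sumL-concatMap (x ∷ xs) g f =
  ≡-trans (sumL-++ (g x) (concatMap g xs) f) (cong (sumL (g x) f +_) (sumL-concatMap xs g f))

sumL-swap : {A B : Set} (xs : List A) (ys : List B) (F : A → B → ℚ) →
  sumL xs (λ x → sumL ys (F x)) ≡ sumL ys (λ y → sumL xs (λ x → F x y))
sumL-swap [] ys F = sym (sumL-zero ys)
sumL-swap (x ∷ xs) ys F =
  ≡-trans (cong (sumL ys (F x) +_) (sumL-swap xs ys F)) (sym (sumL-+ ys (F x) (λ y → sumL xs (λ x → F x y))))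

sumL-filter : {A : Set} {P : A → Set} (P? : ∀ x → Dec (P x)) (xs : List A) (f : A → ℚ) →
  sumL (filter P? xs) f ≡ sumL xs (λ x → if does (P? x) then f x else 0ℚ)
sumL-filter P? [] f = refl
sumL-filter P? (x ∷ xs) f with does (P? x)
... | true = cong (f x +_) (sumL-filter P? xs f)
... | false = ≡-trans (sumL-filter P? xs f) (sym (QP.+-identityˡ _))

sumL-mono : {A : Set} (xs : List A) {f g : A → ℚ} → (∀ x → f x ≤q g x) → sumL xs f ≤q sumL xs g
sumL-mono [] le = QP.≤-refl
sumL-mono (x ∷ xs) le = QP.+-mono-≤ (le x) (sumL-mono xs le)

sumL-nonNeg : {A : Set} (xs : List A) {f : A → ℚ} → (∀ x → 0ℚ ≤q f x) → 0ℚ ≤q sumL xs f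
sumL-nonNeg xs nn = QP.≤-trans (QP.≤-reflexive (sym (sumL-zero xs))) (sumL-mono xs nn)

𝟙 : Bool → ℚ
𝟙 true = 1ℚ
𝟙 false = 0ℚ

𝟙-∧ : ∀ a b → 𝟙 (a ∧ b) ≡ 𝟙 a * 𝟙 b
𝟙-∧ true b = sym (QP.*-identityˡ (𝟙 b))
𝟙-∧ false b = sym (QP.*-zeroˡ (𝟙 b))

if-then-0≡𝟙* : ∀ (c : Bool) p → (if c then p else 0ℚ) ≡ 𝟙 c * p
if-then-0≡𝟙* true p = sym (QP.*-identityˡ p)
if-then-0≡𝟙* false p = sym (QP.*-zeroˡ p)

∧-elimˡ : ∀ {a b} → (a ∧ b) ≡ true → a ≡ true
∧-elimˡ {true} e = refl

∧-elimʳ : ∀ {a b} → (a ∧ b) ≡ true → b ≡ true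
∧-elimʳ {true} e = e

∧-trueʳ : ∀ a → (a ∧ true) ≡ a
∧-trueʳ true = refl
∧-trueʳ false = refl

countB-++ : {A : Set} (p : A → Bool) (xs ys : List A) → countB p (xs ++ ys) ≡ countB p xs N.+ countB p ys
countB-++ p [] ys = refl
countB-++ p (x ∷ xs) ys with p x
... | true = cong suc (countB-++ p xs ys)
... | false = countB-++ p xs ys

countB-↭ : {A : Set} (p : A → Bool) {xs ys : List A} → xs ↭ ys → countB p xs ≡ countB p ys
countB-↭ p Perm.refl = refl
countB-↭ p (Perm.prep x r) with p x
... | true = cong suc (countB-↭ p r)
... | false = countB-↭ p r
countB-↭ p (Perm.swap x y r) with p x | p y
... | true | true = cong (λ n → suc (suc n)) (countB-↭ p r)
... | true | false = cong suc (countB-↭ p r)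
... | false | true = cong suc (countB-↭ p r)
... | false | false = countB-↭ p r
countB-↭ p (Perm.trans r s) = ≡-trans (countB-↭ p r) (countB-↭ p s)

countB-reverse : {A : Set} (p : A → Bool) (xs : List A) → countB p (reverse xs) ≡ countB p xs
countB-reverse p xs = countB-↭ p (↭-reverse xs)

countB-replicate : {A : Set} (p : A → Bool) (a : A) → p a ≡ false → ∀ k → countB p (replicate k a) ≡ 0
countB-replicate p a pa zero = refl
countB-replicate p a pa (suc k) rewrite pa = countB-replicate p a pa k

countB-const-false : {A : Set} (xs : List A) → countB (λ _ → false) xs ≡ 0
countB-const-false [] = refl
countB-const-false (x ∷ xs) = countB-const-false xs

countB-congOn : {A : Set} {P p q : A → Bool} (xs : List A) → allB P xs ≡ true →
  (∀ y → P y ≡ true → p y ≡ q y) → countB p xs ≡ countB q xs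
countB-congOn [] _ _ = refl
countB-congOn {P = P} {p} {q} (x ∷ xs) all e rewrite e x (∧-elimˡ {P x} all) with q x
... | true = cong suc (countB-congOn xs (∧-elimʳ {P x} all) e)
... | false = countB-congOn xs (∧-elimʳ {P x} all) e

allB-++ : {A : Set} (p : A → Bool) (xs ys : List A) → allB p (xs ++ ys) ≡ (allB p xs ∧ allB p ys)
allB-++ p [] ys = refl
allB-++ p (x ∷ xs) ys with p x
... | true = allB-++ p xs ys
... | false = refl

allB-↭ : {A : Set} (p : A → Bool) {xs ys : List A} → xs ↭ ys → allB p xs ≡ allB p ys
allB-↭ p Perm.refl = refl
allB-↭ p (Perm.prep x r) = cong (p x ∧_) (allB-↭ p r)
allB-↭ p (Perm.swap x y r) with p x | p y
... | true | true = allB-↭ p r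
... | true | false = refl
... | false | true = refl
... | false | false = refl
allB-↭ p (Perm.trans r s) = ≡-trans (allB-↭ p r) (allB-↭ p s)

allB-cong : {A : Set} {p q : A → Bool} (xs : List A) → (∀ x → p x ≡ q x) → allB p xs ≡ allB q xs
allB-cong [] e = refl
allB-cong (x ∷ xs) e = cong₂ _∧_ (e x) (allB-cong xs e)

allB-∈ : {A : Set} {P : A → Bool} (xs : List A) {j : A} → allB P xs ≡ true → j ∈ xs → P j ≡ true
allB-∈ {P = P} (x ∷ xs) all (here refl) = ∧-elimˡ {P x} all
allB-∈ {P = P} (x ∷ xs) all (there j∈xs) = allB-∈ xs (∧-elimʳ {P x} all) j∈xs

allB⇒All : {A : Set} {P : A → Bool} {Q : A → Set} (xs : List A) → allB P xs ≡ true →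
  (∀ c → P c ≡ true → Q c) → All Q xs
allB⇒All [] e f = []
allB⇒All {P = P} (x ∷ xs) e f = f x (∧-elimˡ {P x} e) ∷ allB⇒All xs (∧-elimʳ {P x} e) f

-- Entries, ball ranges and validity

<ᵇ⇒< : ∀ k b → (k N.<ᵇ b) ≡ true → suc k ≤ b
<ᵇ⇒< zero (suc b) e = s≤s z≤n
<ᵇ⇒< (suc k) (suc b) e = s≤s (<ᵇ⇒< k b e)

<⇒<ᵇ : ∀ k b → suc k ≤ b → (k N.<ᵇ b) ≡ true
<⇒<ᵇ zero (suc b) _ = refl
<⇒<ᵇ (suc k) (suc b) (s≤s le) = <⇒<ᵇ k b le

≥⇒<ᵇ-false : ∀ k b → b ≤ k → (k N.<ᵇ b) ≡ false
≥⇒<ᵇ-false zero zero _ = refl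
≥⇒<ᵇ-false (suc k) zero _ = refl
≥⇒<ᵇ-false (suc k) (suc b) (s≤s le) = ≥⇒<ᵇ-false k b le

≤ᵇ⇒≤ : ∀ k b → (k N.≤ᵇ b) ≡ true → k ≤ b
≤ᵇ⇒≤ zero b _ = z≤n
≤ᵇ⇒≤ (suc k) b e = <ᵇ⇒< k b e

<ᵇ-suc : ∀ k b → k ≢ b → (k N.<ᵇ suc b) ≡ (k N.<ᵇ b)
<ᵇ-suc zero zero k≢b = ⊥-elim (k≢b refl)
<ᵇ-suc zero (suc b) _ = refl
<ᵇ-suc (suc k) zero _ = refl
<ᵇ-suc (suc k) (suc b) k≢b = <ᵇ-suc k b (λ e → k≢b (cong suc e))

≡ᵇ1⇒≡1 : ∀ n → (n N.≡ᵇ 1) ≡ true → n ≡ 1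
≡ᵇ1⇒≡1 (suc zero) _ = refl

≡ᵇ0⇒≡0 : ∀ n → (n N.≡ᵇ 0) ≡ true → n ≡ 0
≡ᵇ0⇒≡0 zero _ = refl

≤⇒≢suc : ∀ {k b} → k ≤ b → k ≢ suc b
≤⇒≢suc le refl = NP.<-irrefl refl (s≤s le)

inRange⇒≤ : ∀ b k → inRange b (num k) ≡ true → k ≤ b
inRange⇒≤ b k e = ≤ᵇ⇒≤ k b (∧-elimʳ {1 N.≤ᵇ k} e)

inRange⇒≥1 : ∀ b k → inRange b (num k) ≡ true → 1 ≤ k
inRange⇒≥1 b k e = <ᵇ⇒< 0 k (∧-elimˡ {1 N.≤ᵇ k} e)

≟E-num-refl : ∀ k → does (num k ≟E num k) ≡ true
≟E-num-refl k with k N.≟ k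
... | yes refl = refl
... | no k≢k = ⊥-elim (k≢k refl)

≟E-num-≢ : ∀ j k → j ≢ k → does (num j ≟E num k) ≡ false
≟E-num-≢ j k j≢k with j N.≟ k
... | yes refl = ⊥-elim (j≢k refl)
... | no _ = refl

≟E-num-sym : ∀ j k → does (num j ≟E num k) ≡ does (num k ≟E num j)
≟E-num-sym j k with j N.≟ k
... | yes refl = sym (≟E-num-refl j)
... | no j≢k = sym (≟E-num-≢ k j (λ e → j≢k (sym e)))

occ-num-≢ : ∀ j k w → j ≢ k → occ k (num j ∷ w) ≡ occ k w
occ-num-≢ j k w j≢k rewrite ≟E-num-≢ j k j≢k = refl

occ-num-≡ : ∀ k w → occ k (num k ∷ w) ≡ suc (occ k w)
occ-num-≡ k w rewrite ≟E-num-refl k = refl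

ltE-asym : ∀ a c → ltE a c ≡ true → ltE c a ≡ false
ltE-asym (num m) (num n) e = ≥⇒<ᵇ-false n m (NP.<⇒≤ (<ᵇ⇒< m n e))
ltE-asym (num m) dash e = refl

ltE-irrefl : ∀ a → ltE a a ≡ false
ltE-irrefl dash = refl
ltE-irrefl (num n) = ≥⇒<ᵇ-false n n NP.≤-refl

upTo1-bounds : ∀ b {k} → k ∈ upTo1 b → 1 ≤ k × k ≤ b
upTo1-bounds (suc b) k∈ with ∈-++⁻ (upTo1 b) k∈
... | inj₁ k∈b = let (1≤k , k≤b) = upTo1-bounds b k∈b in 1≤k , NP.m≤n⇒m≤1+n k≤b
... | inj₂ (here refl) = s≤s z≤n , NP.≤-refl

∈-upTo1 : ∀ b j → 1 ≤ j → j ≤ b → j ∈ upTo1 b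
∈-upTo1 zero j 1≤j j≤0 = ⊥-elim (NP.<-irrefl refl (NP.≤-trans 1≤j j≤0))
∈-upTo1 (suc b) j 1≤j j≤b with j N.≟ suc b
... | yes refl = ∈-++⁺ʳ (upTo1 b) (here refl)
... | no j≢b = ∈-++⁺ˡ (∈-upTo1 b j 1≤j (NP.≤-pred (NP.≤∧≢⇒< j≤b j≢b)))


countUpTo1-above : ∀ b j → b N.< j → countB (λ k → does (num k ≟E num j)) (upTo1 b) ≡ 0
countUpTo1-above zero j lt = refl
countUpTo1-above (suc b) j lt = ≡-trans (countB-++ _ (upTo1 b) (suc b ∷ []))
  (cong₂ N._+_ (countUpTo1-above b j (NP.≤-trans (NP.n≤1+n _) lt))
    (cong (λ z → if z then 1 else 0) (≟E-num-≢ (suc b) j (λ e → NP.<-irrefl e lt))))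

countUpTo1 : ∀ b j → 1 ≤ j → j ≤ b → countB (λ k → does (num k ≟E num j)) (upTo1 b) ≡ 1
countUpTo1 zero j 1≤j j≤0 = ⊥-elim (NP.<-irrefl refl (NP.≤-trans 1≤j j≤0))
countUpTo1 (suc b) j 1≤j j≤b with j N.≟ suc b
... | yes refl = ≡-trans (countB-++ _ (upTo1 b) (suc b ∷ []))
     (cong₂ N._+_ (countUpTo1-above b (suc b) NP.≤-refl) (cong (λ z → if z then 1 else 0) (≟E-num-refl (suc b))))
... | no j≢b = ≡-trans (countB-++ _ (upTo1 b) (suc b ∷ []))
     (≡-trans (cong₂ N._+_ (countUpTo1 b j 1≤j (NP.≤-pred (NP.≤∧≢⇒< j≤b j≢b)))
                            (cong (λ z → if z then 1 else 0) (≟E-num-≢ (suc b) j (λ e → j≢b (sym e))))) refl)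

length-upTo1 : ∀ b → length (upTo1 b) ≡ b
length-upTo1 zero = refl
length-upTo1 (suc b) = ≡-trans (LP.length-++ (upTo1 b)) (≡-trans (cong (N._+ 1) (length-upTo1 b)) (NP.+-comm b 1))

sumL-cong∈ : {A : Set} (xs : List A) {f g : A → ℚ} → (∀ {x} → x ∈ xs → f x ≡ g x) → sumL xs f ≡ sumL xs g
sumL-cong∈ [] e = refl
sumL-cong∈ (x ∷ xs) e = cong₂ _+_ (e (here refl)) (sumL-cong∈ xs (λ x∈ → e (there x∈)))

allB-cong∈ : {A : Set} (xs : List A) {f g : A → Bool} → (∀ {x} → x ∈ xs → f x ≡ g x) → allB f xs ≡ allB g xs
allB-cong∈ [] e = refl
allB-cong∈ (x ∷ xs) e = cong₂ _∧_ (e (here refl)) (allB-cong∈ xs (λ x∈ → e (there x∈)))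

validB-↭ : ∀ b {xs ys} → xs ↭ ys → validB b xs ≡ validB b ys
validB-↭ b r = cong₂ _∧_ (allB-↭ (inRange b) r) (allB-cong (upTo1 b) (λ k → cong (N._≡ᵇ 1) (countB-↭ _ r)))

validB-reverse : ∀ b w → validB b (reverse w) ≡ validB b w
validB-reverse b w = validB-↭ b (↭-reverse w)

validB-padDashes : ∀ b σ k → validB b (σ ++ replicate k dash) ≡ validB b σ
validB-padDashes b σ k = cong₂ _∧_
  (≡-trans (allB-++ (inRange b) σ (replicate k dash)) (≡-trans (cong (allB (inRange b) σ ∧_) (dashesInRange k)) (∧-trueʳ _)))
  (allB-cong (upTo1 b) (λ j → cong (N._≡ᵇ 1) (≡-trans (countB-++ _ σ (replicate k dash))
    (≡-trans (cong (occ j σ N.+_) (countB-replicate _ dash refl k)) (NP.+-identityʳ _)))))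
  where
  dashesInRange : ∀ k → allB (inRange b) (replicate k dash) ≡ true
  dashesInRange zero = refl
  dashesInRange (suc k) = dashesInRange k

validB-occ≡1 : ∀ b w j → validB b w ≡ true → 1 ≤ j → j ≤ b → occ j w ≡ 1
validB-occ≡1 b w j valid 1≤j j≤b =
  ≡ᵇ1⇒≡1 _ (allB-∈ (upTo1 b) (∧-elimʳ {allB (inRange b) w} valid) (∈-upTo1 b j 1≤j j≤b))

-- Inversions and trailing dashes

countAbove : Word → Entry → ℕ
countAbove r a = countB (λ y → gtE y a) r

countAbove-dash : ∀ r → countAbove r dash ≡ 0
countAbove-dash r = countB-const-false r

inversions-snoc : ∀ u a → inversions (u ++ a ∷ []) ≡ inversions u N.+ countAbove u a
inversions-snoc [] a = refl
inversions-snoc (x ∷ u) a rewrite countB-++ (gtE x) u (a ∷ []) | inversions-snoc u a with gtE x a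
... | true = solve 3 (λ m n k → m :+ con 1 :+ (n :+ k) := m :+ n :+ (con 1 :+ k)) refl
               (countB (gtE x) u) (inversions u) (countAbove u a)
  where open NS.+-*-Solver
... | false = solve 3 (λ m n k → m :+ con 0 :+ (n :+ k) := m :+ n :+ k) refl
               (countB (gtE x) u) (inversions u) (countAbove u a)
  where open NS.+-*-Solver

inversions-padDashes : ∀ u k → inversions (u ++ replicate k dash) ≡ inversions u
inversions-padDashes [] zero = refl
inversions-padDashes [] (suc k) =
  ≡-trans (cong (N._+ inversions (replicate k dash)) (countB-replicate (gtE dash) dash refl k)) (inversions-padDashes [] k)
inversions-padDashes (x ∷ u) k
  rewrite countB-++ (gtE x) u (replicate k dash) | countB-replicate (gtE x) dash refl k | NP.+-identityʳ (countB (gtE x) u) =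
  cong (countB (gtE x) u N.+_) (inversions-padDashes u k)

-- ℓ of a word given from right to left.
revInversions : Word → ℕ
revInversions [] = 0
revInversions (a ∷ r) = revInversions r N.+ countAbove r a

revInversions≡inversions-reverse : ∀ s → revInversions s ≡ inversions (reverse s)
revInversions≡inversions-reverse [] = refl
revInversions≡inversions-reverse (a ∷ r) =
  ≡-trans (cong₂ N._+_ (revInversions≡inversions-reverse r) (sym (countB-reverse (λ y → gtE y a) r)))
  (≡-trans (sym (inversions-snoc (reverse r) a)) (cong inversions (sym (LP.unfold-reverse a r))))

revInversions-dash∷reverse : ∀ w → revInversions (dash ∷ reverse w) ≡ inversions w
revInversions-dash∷reverse w =
  ≡-trans (cong (revInversions (reverse w) N.+_) (countAbove-dash (reverse w)))
  (≡-trans (NP.+-identityʳ _) (≡-trans (revInversions≡inversions-reverse (reverse w)) (cong inversions (LP.reverse-involutive w))))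

trimCons : Entry → Word → Word
trimCons x [] = if isDash x then [] else x ∷ []
trimCons x (y ∷ ys) = x ∷ y ∷ ys

trim-∷ : ∀ x xs → trim (x ∷ xs) ≡ trimCons x (trim xs)
trim-∷ x xs with trim xs
... | [] = refl
... | y ∷ ys = refl

trim-replicate-dash : ∀ k → trim (replicate k dash) ≡ []
trim-replicate-dash zero = refl
trim-replicate-dash (suc k) = ≡-trans (trim-∷ dash (replicate k dash)) (cong (trimCons dash) (trim-replicate-dash k))

trim-padDashes : ∀ u k → trim (u ++ replicate k dash) ≡ trim u
trim-padDashes [] k = trim-replicate-dash k
trim-padDashes (x ∷ u) k =
  ≡-trans (trim-∷ x (u ++ replicate k dash)) (≡-trans (cong (trimCons x) (trim-padDashes u k)) (sym (trim-∷ x u)))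

trim-padding : ∀ w → Σ ℕ (λ k → w ≡ trim w ++ replicate k dash)
trim-padding [] = 0 , refl
trim-padding (x ∷ xs) with trim xs | trim-padding xs
trim-padding (dash ∷ xs) | [] | k , e = suc k , cong (dash ∷_) e
trim-padding (num n ∷ xs) | [] | k , e = k , cong (num n ∷_) e
... | y ∷ ys | k , e = k , cong (x ∷_) e

trim-idempotent : ∀ w → trim (trim w) ≡ trim w
trim-idempotent w with trim-padding w
... | k , e = sym (≡-trans (cong trim e) (trim-padDashes (trim w) k))

inversions-trim : ∀ w → inversions (trim w) ≡ inversions w
inversions-trim w with trim-padding w
... | k , e = sym (≡-trans (cong inversions e) (inversions-padDashes (trim w) k))

padTo : ℕ → Word → Word
padTo M σ = σ ++ replicate (M N.∸ length σ) dash

padTo-unique : ∀ v σ M → length v ≡ M → trim v ≡ σ → v ≡ padTo M σ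
padTo-unique v σ M length-v trim-v with trim-padding v
... | k , v≡ = ≡-trans v≡ (cong₂ (λ A B → A ++ replicate B dash) trim-v (sym k≡))
  where
  k≡ : M N.∸ length σ ≡ k
  k≡ = ≡-trans (cong₂ N._∸_ (≡-trans (sym length-v) (≡-trans (cong length v≡)
                 (≡-trans (LP.length-++ (trim v)) (cong (length (trim v) N.+_) (LP.length-replicate k)))))
                 (cong length (sym trim-v)))
       (NP.m+n∸m≡n (length (trim v)) k)

length-padTo : ∀ M σ → length σ ≤ M → length (padTo M σ) ≡ M
length-padTo M σ σ-fits = ≡-trans (LP.length-++ σ) (≡-trans (cong (length σ N.+_) (LP.length-replicate _)) (NP.m+[n∸m]≡n σ-fits))

validB-reverse-padTo : ∀ b M σ → validB b σ ≡ true → validB b (reverse (padTo M σ)) ≡ true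
validB-reverse-padTo b M σ valid-σ = ≡-trans (validB-reverse b (padTo M σ)) (≡-trans (validB-padDashes b σ _) valid-σ)

reverse-replicate : ∀ k (a : Entry) → reverse (replicate k a) ≡ replicate k a
reverse-replicate zero a = refl
reverse-replicate (suc k) a = ≡-trans (LP.unfold-reverse a (replicate k a)) (≡-trans (cong (_++ a ∷ []) (reverse-replicate k a)) (snoc k))
  where
  snoc : ∀ k → replicate k a ++ a ∷ [] ≡ a ∷ replicate k a
  snoc zero = refl
  snoc (suc k) = cong (a ∷_) (snoc k)

does-⇔ : ∀ {A B : Set} (a? : Dec A) (b? : Dec B) → (A → B) → (B → A) → does a? ≡ does b?
does-⇔ (yes a) (yes b) f g = refl
does-⇔ (yes a) (no ¬b) f g = ⊥-elim (¬b (f a))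
does-⇔ (no ¬a) (yes b) f g = ⊥-elim (¬a (g b))
does-⇔ (no ¬a) (no ¬b) f g = refl

does-trim-reverse≟ : ∀ M σ u → trim σ ≡ σ → length u ≡ M → does (trim (reverse u) ≟W σ) ≡ does (u ≟W reverse (padTo M σ))
does-trim-reverse≟ M σ u trim-σ length-u = does-⇔ (trim (reverse u) ≟W σ) (u ≟W reverse (padTo M σ)) to from
  where
  to : trim (reverse u) ≡ σ → u ≡ reverse (padTo M σ)
  to e = ≡-trans (sym (LP.reverse-involutive u))
    (cong reverse (padTo-unique (reverse u) σ M (≡-trans (LP.length-reverse u) length-u) e))
  from : u ≡ reverse (padTo M σ) → trim (reverse u) ≡ σ
  from refl = ≡-trans (cong trim (LP.reverse-involutive (padTo M σ))) (≡-trans (trim-padDashes σ _) trim-σ)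

trim-endsInNum : ∀ w → (trim w ≡ []) ⊎ Σ Word (λ t → Σ ℕ (λ j → trim w ≡ t ++ num j ∷ []))
trim-endsInNum [] = inj₁ refl
trim-endsInNum (x ∷ xs) rewrite trim-∷ x xs with trim xs | trim-endsInNum xs
trim-endsInNum (dash ∷ xs) | .[] | inj₁ refl = inj₁ refl
trim-endsInNum (num n ∷ xs) | .[] | inj₁ refl = inj₂ ([] , n , refl)
trim-endsInNum (x ∷ xs) | .(t ++ num j ∷ []) | inj₂ (t , j , refl) with t
... | [] = inj₂ (x ∷ [] , j , refl)
... | z ∷ t' = inj₂ (x ∷ z ∷ t' , j , refl)

trim-nonEmpty : ∀ b w → 1 ≤ b → validB b w ≡ true → trim w ≢ []
trim-nonEmpty b w 1≤b valid trim≡[] with trim-padding w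
... | k , e = NP.1+n≢0 (≡-trans (sym (validB-occ≡1 b w 1 valid NP.≤-refl 1≤b))
                (≡-trans (cong (occ 1) (≡-trans e (cong (_++ replicate k dash) trim≡[]))) (countB-replicate _ dash refl k)))

-- Sums over all words of a given length

letters : ℕ → List Entry
letters b = dash ∷ map num (upTo1 b)

sumWords-∷ : ∀ b n (F : Word → ℚ) →
  sumL (allWords b (suc n)) F ≡ sumL (allWords b n) (λ w → sumL (letters b) (λ e → F (e ∷ w)))
sumWords-∷ b n F = ≡-trans (sumL-concatMap (allWords b n) (λ w → map (λ e → e ∷ w) (letters b)) F)
  (sumL-cong (allWords b n) (λ w → sumL-map (letters b) (λ e → e ∷ w) F))

sumWords-snoc : ∀ b n (F : Word → ℚ) →
  sumL (allWords b (suc n)) F ≡ sumL (letters b) (λ e → sumL (allWords b n) (λ w → F (w ++ e ∷ [])))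
sumWords-snoc b zero F = ≡-trans (sumWords-∷ b zero F)
  (≡-trans (QP.+-identityʳ (sumL (letters b) (λ e → F (e ∷ [])))) (sumL-cong (letters b) (λ e → sym (QP.+-identityʳ (F (e ∷ []))))))
sumWords-snoc b (suc n) F =
  ≡-trans (sumWords-∷ b (suc n) F)
  (≡-trans (sumWords-snoc b n (λ w → sumL (letters b) (λ e' → F (e' ∷ w))))
  (sumL-cong (letters b) (λ e → sym (sumWords-∷ b n (λ w → F (w ++ e ∷ []))))))

sumWords-reverse : ∀ b n (F : Word → ℚ) → sumL (allWords b n) (λ w → F (reverse w)) ≡ sumL (allWords b n) F
sumWords-reverse b zero F = refl
sumWords-reverse b (suc n) F =
  ≡-trans (sumWords-∷ b n (λ w → F (reverse w)))
  (≡-trans (sumL-cong (allWords b n) (λ w → sumL-cong (letters b) (λ e → cong F (LP.unfold-reverse e w))))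
  (≡-trans (sumL-swap (allWords b n) (letters b) (λ w e → F (reverse w ++ e ∷ [])))
  (≡-trans (sumL-cong (letters b) (λ e → sumWords-reverse b n (λ u → F (u ++ e ∷ []))))
  (sym (sumWords-snoc b n F)))))

sumWords-cong : ∀ b n {F G : Word → ℚ} → (∀ w → length w ≡ n → F w ≡ G w) → sumL (allWords b n) F ≡ sumL (allWords b n) G
sumWords-cong b zero e = cong (_+ 0ℚ) (e [] refl)
sumWords-cong b (suc n) {F} {G} e = ≡-trans (sumWords-∷ b n F) (≡-trans
  (sumWords-cong b n (λ w lw → sumL-cong (letters b) (λ x → e (x ∷ w) (cong suc lw)))) (sym (sumWords-∷ b n G)))

sumWords-0 : ∀ N (F : Word → ℚ) → sumL (allWords 0 N) F ≡ F (replicate N dash)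
sumWords-0 zero F = QP.+-identityʳ (F [])
sumWords-0 (suc N) F = ≡-trans (sumWords-∷ 0 N F) (≡-trans (sumWords-0 N (λ w → F (dash ∷ w) + 0ℚ)) (QP.+-identityʳ _))


sum-statesIn : ∀ b N (f : Word → ℚ) → sumℚ (map f (statesIn b N)) ≡ sumL (allWords b N) (λ w → 𝟙 (validB b w) * f (trim w))
sum-statesIn b N f =
  ≡-trans (sumℚ-map (statesIn b N) f)
  (≡-trans (sumL-map (filter (λ w → validB b w ≟B true) (allWords b N)) trim f)
  (≡-trans (sumL-filter (λ w → validB b w ≟B true) (allWords b N) (λ w → f (trim w)))
  (sumL-cong (allWords b N) (λ w → ≡-trans (cong (λ c → if c then f (trim w) else 0ℚ) (does-≟B (validB b w)))
                                           (if-then-0≡𝟙* (validB b w) (f (trim w)))))))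
  where
  does-≟B : ∀ c → does (c ≟B true) ≡ c
  does-≟B true = refl
  does-≟B false = refl

sumLetters-cong : ∀ b {f g : Entry → ℚ} → f dash ≡ g dash → (∀ k → 1 ≤ k → k ≤ b → f (num k) ≡ g (num k)) →
  sumL (letters b) f ≡ sumL (letters b) g
sumLetters-cong b {f} {g} e0 ek = cong₂ _+_ e0 (≡-trans (sumL-map (upTo1 b) num f)
  (≡-trans (sumL-cong∈ (upTo1 b) (λ {k} k∈ → ek k (proj₁ (upTo1-bounds b k∈)) (proj₂ (upTo1-bounds b k∈))))
  (sym (sumL-map (upTo1 b) num g))))

sumLetters-suc : ∀ b (f : Entry → ℚ) → sumL (letters (suc b)) f ≡ sumL (letters b) f + f (num (suc b))
sumLetters-suc b f = ≡-trans (cong (f dash +_) (≡-trans (cong (λ l → sumL l f) (LP.map-++ num (upTo1 b) (suc b ∷ [])))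
    (sumL-++ (map num (upTo1 b)) (num (suc b) ∷ []) f)))
  (solve 3 (λ a s c → a :+ (s :+ (c :+ con 0ℚ)) := a :+ s :+ c) refl (f dash) (sumL (map num (upTo1 b)) f) (f (num (suc b))))
  where open +-*-Solver

count : Entry → List Entry → ℕ
count c = countB (λ e → does (e ≟E c))

sumL-δ-absent : ∀ c (xs : List Entry) (f : Entry → ℚ) → count c xs ≡ 0 → sumL xs (λ e → 𝟙 (does (e ≟E c)) * f e) ≡ 0ℚ
sumL-δ-absent c [] f _ = refl
sumL-δ-absent c (x ∷ xs) f z with x ≟E c
... | no _ = cong₂ _+_ (QP.*-zeroˡ (f x)) (sumL-δ-absent c xs f z)

sumL-δ-once : ∀ c (xs : List Entry) (f : Entry → ℚ) → count c xs ≡ 1 → sumL xs (λ e → 𝟙 (does (e ≟E c)) * f e) ≡ f c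
sumL-δ-once c (x ∷ xs) f z with x ≟E c
... | yes refl = ≡-trans (cong₂ _+_ (QP.*-identityˡ (f x)) (sumL-δ-absent x xs f (NP.suc-injective z))) (QP.+-identityʳ (f x))
... | no _ = ≡-trans (cong₂ _+_ (QP.*-zeroˡ (f x)) (sumL-δ-once c xs f z)) (QP.+-identityˡ (f c))

count-letters : ∀ b c → inRange b c ≡ true → count c (letters b) ≡ 1
count-letters b dash _ = cong suc (noDash (upTo1 b))
  where
  noDash : ∀ (xs : List ℕ) → count dash (map num xs) ≡ 0
  noDash [] = refl
  noDash (x ∷ xs) = noDash xs
count-letters b (num j) e = ≡-trans (count-map (upTo1 b)) (countUpTo1 b j (inRange⇒≥1 b j e) (inRange⇒≤ b j e))
  where
  count-map : ∀ (xs : List ℕ) → count (num j) (map num xs) ≡ countB (λ k → does (num k ≟E num j)) xs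
  count-map [] = refl
  count-map (x ∷ xs) with does (num x ≟E num j)
  ... | true = cong suc (count-map xs)
  ... | false = count-map xs

-- Inserting the largest ball

sumLetters-occTop : ∀ b w (G : ℕ → Entry → ℚ) →
  sumL (letters b) (λ e → G (occ (suc b) (e ∷ w)) e) ≡ sumL (letters b) (λ e → G (occ (suc b) w) e)
sumLetters-occTop b w G = sumLetters-cong b {λ e → G (occ (suc b) (e ∷ w)) e} {λ e → G (occ (suc b) w) e} refl
  (λ k _ k≤b → cong (λ n → G n (num k)) (occ-num-≢ k (suc b) w (≤⇒≢suc k≤b)))

sumReplaceDash : ℕ → (Word → ℚ) → Word → ℚ
sumReplaceDash B F [] = 0ℚ
sumReplaceDash B F (dash ∷ w) = F (num B ∷ w) + sumReplaceDash B (λ x → F (dash ∷ x)) w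
sumReplaceDash B F (num k ∷ w) = sumReplaceDash B (λ x → F (num k ∷ x)) w

sumReplaceDash-cong : ∀ B {F F' : Word → ℚ} w → (∀ x → F x ≡ F' x) → sumReplaceDash B F w ≡ sumReplaceDash B F' w
sumReplaceDash-cong B [] e = refl
sumReplaceDash-cong B (dash ∷ w) e = cong₂ _+_ (e _) (sumReplaceDash-cong B w (λ x → e (dash ∷ x)))
sumReplaceDash-cong B (num k ∷ w) e = sumReplaceDash-cong B w (λ x → e (num k ∷ x))

hasTopOnce lacksTop : ℕ → Word → Bool
hasTopOnce b w = occ (suc b) w N.≡ᵇ 1
lacksTop b w = occ (suc b) w N.≡ᵇ 0

sumLetters-hasTopOnce : ∀ b (F : Word → ℚ) w →
  sumL (letters (suc b)) (λ e → 𝟙 (hasTopOnce b (e ∷ w)) * F (e ∷ w))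
    ≡ sumL (letters b) (λ e → 𝟙 (hasTopOnce b w) * F (e ∷ w)) + 𝟙 (lacksTop b w) * F (num (suc b) ∷ w)
sumLetters-hasTopOnce b F w = ≡-trans (sumLetters-suc b (λ e → 𝟙 (hasTopOnce b (e ∷ w)) * F (e ∷ w)))
  (cong₂ _+_ (sumLetters-occTop b w (λ n e → 𝟙 (n N.≡ᵇ 1) * F (e ∷ w)))
             (cong (λ n → 𝟙 (n N.≡ᵇ 1) * F (num (suc b) ∷ w)) (occ-num-≡ (suc b) w)))

sumLetters-sumReplaceDash : ∀ b (F : Word → ℚ) w →
  sumL (letters (suc b)) (λ e → 𝟙 (lacksTop b (e ∷ w)) * sumReplaceDash (suc b) F (e ∷ w))
    ≡ sumL (letters b) (λ e → 𝟙 (lacksTop b w) * sumReplaceDash (suc b) (λ x → F (e ∷ x)) w) + 𝟙 (lacksTop b w) * F (num (suc b) ∷ w)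
sumLetters-sumReplaceDash b F w = begin
    sumL (letters (suc b)) (λ e → 𝟙 (lacksTop b (e ∷ w)) * sumReplaceDash (suc b) F (e ∷ w))
  ≡⟨ sumLetters-suc b (λ e → 𝟙 (lacksTop b (e ∷ w)) * sumReplaceDash (suc b) F (e ∷ w)) ⟩
    sumL (letters b) (λ e → 𝟙 (lacksTop b (e ∷ w)) * sumReplaceDash (suc b) F (e ∷ w))
      + 𝟙 (lacksTop b (B ∷ w)) * sumReplaceDash (suc b) F (B ∷ w)
  ≡⟨ cong₂ _+_ (sumLetters-occTop b w (λ n e → 𝟙 (n N.≡ᵇ 0) * sumReplaceDash (suc b) F (e ∷ w)))
               (≡-trans (cong (λ n → 𝟙 (n N.≡ᵇ 0) * sumReplaceDash (suc b) F (B ∷ w)) (occ-num-≡ (suc b) w))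
                        (QP.*-zeroˡ (sumReplaceDash (suc b) F (B ∷ w)))) ⟩
    (ι * (F (B ∷ w) + R dash) + sumL (map num (upTo1 b)) (λ e → ι * sumReplaceDash (suc b) F (e ∷ w))) + 0ℚ
  ≡⟨ cong (λ z → (ι * (F (B ∷ w) + R dash) + z) + 0ℚ)
          (≡-trans (sumL-map (upTo1 b) num (λ e → ι * sumReplaceDash (suc b) F (e ∷ w))) (sym (sumL-map (upTo1 b) num (λ e → ι * R e)))) ⟩
    (ι * (F (B ∷ w) + R dash) + S) + 0ℚ
  ≡⟨ solve 4 (λ i f r s → (i :* (f :+ r) :+ s) :+ con 0ℚ := (i :* r :+ s) :+ i :* f) refl ι (F (B ∷ w)) (R dash) S ⟩
    sumL (letters b) (λ e → ι * R e) + ι * F (B ∷ w)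
  ∎
  where
  open ≡-Reasoning
  open +-*-Solver
  B = num (suc b)
  ι = 𝟙 (lacksTop b w)
  R : Entry → ℚ
  R e = sumReplaceDash (suc b) (λ x → F (e ∷ x)) w
  S = sumL (map num (upTo1 b)) (λ e → ι * R e)

sumWords-hasTopOnce : ∀ b N (F : Word → ℚ) →
  sumL (allWords (suc b) N) (λ w → 𝟙 (hasTopOnce b w) * F w)
    ≡ sumL (allWords (suc b) N) (λ w → 𝟙 (lacksTop b w) * sumReplaceDash (suc b) F w)
sumWords-hasTopOnce b zero F = cong (_+ 0ℚ) (≡-trans (QP.*-zeroˡ (F [])) (sym (QP.*-zeroʳ 1ℚ)))
sumWords-hasTopOnce b (suc N) F = begin
    sumL (allWords (suc b) (suc N)) (λ w → 𝟙 (hasTopOnce b w) * F w)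
  ≡⟨ sumWords-∷ (suc b) N (λ w → 𝟙 (hasTopOnce b w) * F w) ⟩
    sumL W (λ w → sumL (letters (suc b)) (λ e → 𝟙 (hasTopOnce b (e ∷ w)) * F (e ∷ w)))
  ≡⟨ sumL-cong W (sumLetters-hasTopOnce b F) ⟩
    sumL W (λ w → sumL (letters b) (λ e → 𝟙 (hasTopOnce b w) * F (e ∷ w)) + 𝟙 (lacksTop b w) * F (B ∷ w))
  ≡⟨ sumL-+ W (λ w → sumL (letters b) (λ e → 𝟙 (hasTopOnce b w) * F (e ∷ w))) (λ w → 𝟙 (lacksTop b w) * F (B ∷ w)) ⟩
    sumL W (λ w → sumL (letters b) (λ e → 𝟙 (hasTopOnce b w) * F (e ∷ w))) + T
  ≡⟨ cong (_+ T) (sumL-swap W (letters b) (λ w e → 𝟙 (hasTopOnce b w) * F (e ∷ w))) ⟩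
    sumL (letters b) (λ e → sumL W (λ w → 𝟙 (hasTopOnce b w) * F (e ∷ w))) + T
  ≡⟨ cong (_+ T) (sumL-cong (letters b) (λ e → sumWords-hasTopOnce b N (λ x → F (e ∷ x)))) ⟩
    sumL (letters b) (λ e → sumL W (λ w → 𝟙 (lacksTop b w) * R e w)) + T
  ≡⟨ cong (_+ T) (sym (sumL-swap W (letters b) (λ w e → 𝟙 (lacksTop b w) * R e w))) ⟩
    sumL W (λ w → sumL (letters b) (λ e → 𝟙 (lacksTop b w) * R e w)) + T
  ≡⟨ sym (sumL-+ W (λ w → sumL (letters b) (λ e → 𝟙 (lacksTop b w) * R e w)) (λ w → 𝟙 (lacksTop b w) * F (B ∷ w))) ⟩
    sumL W (λ w → sumL (letters b) (λ e → 𝟙 (lacksTop b w) * R e w) + 𝟙 (lacksTop b w) * F (B ∷ w))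
  ≡⟨ sumL-cong W (λ w → sym (sumLetters-sumReplaceDash b F w)) ⟩
    sumL W (λ w → sumL (letters (suc b)) (λ e → 𝟙 (lacksTop b (e ∷ w)) * sumReplaceDash (suc b) F (e ∷ w)))
  ≡⟨ sym (sumWords-∷ (suc b) N (λ w → 𝟙 (lacksTop b w) * sumReplaceDash (suc b) F w)) ⟩
    sumL (allWords (suc b) (suc N)) (λ w → 𝟙 (lacksTop b w) * sumReplaceDash (suc b) F w)
  ∎
  where
  open ≡-Reasoning
  W = allWords (suc b) N
  B = num (suc b)
  T = sumL W (λ w → 𝟙 (lacksTop b w) * F (B ∷ w))
  R : Entry → Word → ℚ
  R e = sumReplaceDash (suc b) (λ x → F (e ∷ x))

sumWords-lacksTop : ∀ b N (F : Word → ℚ) →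
  sumL (allWords (suc b) N) (λ w → 𝟙 (lacksTop b w) * F w) ≡ sumL (allWords b N) (λ w → 𝟙 (lacksTop b w) * F w)
sumWords-lacksTop b zero F = refl
sumWords-lacksTop b (suc N) F =
  ≡-trans (sumWords-∷ (suc b) N (λ w → 𝟙 (lacksTop b w) * F w))
  (≡-trans (sumL-cong (allWords (suc b) N) (λ w →
              ≡-trans (sumLetters-suc b (λ e → 𝟙 (lacksTop b (e ∷ w)) * F (e ∷ w)))
              (≡-trans (cong₂ _+_ (sumLetters-ι w)
                                  (≡-trans (cong (λ n → 𝟙 (n N.≡ᵇ 0) * F (num (suc b) ∷ w)) (occ-num-≡ (suc b) w)) (QP.*-zeroˡ (F (num (suc b) ∷ w)))))
              (QP.+-identityʳ _))))
  (≡-trans (sumWords-lacksTop b N (λ w → sumL (letters b) (λ e → F (e ∷ w))))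
  (≡-trans (sumL-cong (allWords b N) (λ w → sym (sumLetters-ι w)))
  (sym (sumWords-∷ b N (λ w → 𝟙 (lacksTop b w) * F w))))))
  where
  sumLetters-ι : ∀ w → sumL (letters b) (λ e → 𝟙 (lacksTop b (e ∷ w)) * F (e ∷ w)) ≡ 𝟙 (lacksTop b w) * sumL (letters b) (λ e → F (e ∷ w))
  sumLetters-ι w = ≡-trans (sumLetters-occTop b w (λ n e → 𝟙 (n N.≡ᵇ 0) * F (e ∷ w))) (sumL-*ˡ (letters b) (𝟙 (lacksTop b w)) (λ e → F (e ∷ w)))

inRange-suc : ∀ b xs → occ (suc b) xs ≡ 0 → allB (inRange (suc b)) xs ≡ allB (inRange b) xs
inRange-suc b [] z = refl
inRange-suc b (dash ∷ xs) z = inRange-suc b xs z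
inRange-suc b (num k ∷ xs) z = cong₂ _∧_ (cong ((1 N.≤ᵇ k) ∧_) (≤ᵇ-suc k k≢top)) (inRange-suc b xs (≡-trans (sym (occ-num-≢ k (suc b) xs k≢top)) z))
  where
  k≢top : k ≢ suc b
  k≢top refl = NP.1+n≢0 (≡-trans (sym (occ-num-≡ k xs)) z)
  ≤ᵇ-suc : ∀ k → k ≢ suc b → (k N.≤ᵇ suc b) ≡ (k N.≤ᵇ b)
  ≤ᵇ-suc zero _ = refl
  ≤ᵇ-suc (suc k) k≢ = <ᵇ-suc k b (λ e → k≢ (cong suc e))

validB-replaceDash : ∀ b u v → occ (suc b) (u ++ dash ∷ v) ≡ 0 →
  validB (suc b) (u ++ num (suc b) ∷ v) ≡ validB b (u ++ dash ∷ v)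
validB-replaceDash b u v z = cong₂ _∧_ inRange-part occ-part
  where
  zs : occ (suc b) u N.+ occ (suc b) v ≡ 0
  zs = ≡-trans (sym (countB-++ _ u (dash ∷ v))) z
  zu = NP.m+n≡0⇒m≡0 (occ (suc b) u) zs
  zv = NP.m+n≡0⇒n≡0 (occ (suc b) u) zs
  inRange-part : allB (inRange (suc b)) (u ++ num (suc b) ∷ v) ≡ allB (inRange b) (u ++ dash ∷ v)
  inRange-part rewrite allB-++ (inRange (suc b)) u (num (suc b) ∷ v) | allB-++ (inRange b) u (dash ∷ v)
    | inRange-suc b u zu | inRange-suc b v zv | <⇒<ᵇ b (suc b) NP.≤-refl = refl
  occ-part : allB (λ k → occ k (u ++ num (suc b) ∷ v) N.≡ᵇ 1) (upTo1 b ++ suc b ∷ []) ≡ allB (λ k → occ k (u ++ dash ∷ v) N.≡ᵇ 1) (upTo1 b)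
  occ-part = ≡-trans (allB-++ _ (upTo1 b) (suc b ∷ []))
    (≡-trans (cong₂ _∧_
      (allB-cong∈ (upTo1 b) (λ {k} k∈ → cong (N._≡ᵇ 1) (≡-trans (countB-++ _ u (num (suc b) ∷ v))
        (≡-trans (cong (occ k u N.+_) (occ-num-≢ (suc b) k v (λ e → ≤⇒≢suc (proj₂ (upTo1-bounds b k∈)) (sym e))))
        (sym (countB-++ _ u (dash ∷ v)))))))
      (cong (λ n → (n N.≡ᵇ 1) ∧ true) (≡-trans (countB-++ _ u (num (suc b) ∷ v)) (cong₂ N._+_ zu (≡-trans (occ-num-≡ (suc b) v) (cong suc zv))))))
    (∧-trueʳ _))

dashes : Word → ℕ
dashes = countB isDash

-- Like the dash it replaces, the top ball is above every later number; unlike it, it is below the dashes of u.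
inversions-replaceDash : ∀ b u v → allB (inRange b) (u ++ dash ∷ v) ≡ true →
  inversions (u ++ num (suc b) ∷ v) ≡ inversions (u ++ dash ∷ v) N.+ dashes u
inversions-replaceDash b [] v e = ≡-trans (cong (N._+ inversions v) (countB-congOn v e top>≡dash>)) (sym (NP.+-identityʳ _))
  where
  top>≡dash> : ∀ y → inRange b y ≡ true → gtE (num (suc b)) y ≡ gtE dash y
  top>≡dash> dash _ = refl
  top>≡dash> (num k) iy = <⇒<ᵇ k (suc b) (s≤s (inRange⇒≤ b k iy))
inversions-replaceDash b (dash ∷ u) v e
  rewrite countB-++ (gtE dash) u (num (suc b) ∷ v) | countB-++ (gtE dash) u (dash ∷ v) | inversions-replaceDash b u v e =
  solve 4 (λ a c i d → a :+ (con 1 :+ c) :+ (i :+ d) := a :+ c :+ i :+ (con 1 :+ d)) refl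
    (countB (gtE dash) u) (countB (gtE dash) v) (inversions (u ++ dash ∷ v)) (dashes u)
  where open NS.+-*-Solver
inversions-replaceDash b (num k ∷ u) v e
  rewrite countB-++ (gtE (num k)) u (num (suc b) ∷ v) | countB-++ (gtE (num k)) u (dash ∷ v)
  | inversions-replaceDash b u v (∧-elimʳ {inRange b (num k)} e)
  | ≥⇒<ᵇ-false (suc b) k (NP.m≤n⇒m≤1+n (inRange⇒≤ b k (∧-elimˡ {inRange b (num k)} e))) =
  sym (NP.+-assoc (countB (gtE (num k)) u N.+ countB (gtE (num k)) v) (inversions (u ++ dash ∷ v)) (dashes u))

sumN : List ℕ → (ℕ → ℕ) → ℕ
sumN [] f = 0
sumN (x ∷ xs) f = f x N.+ sumN xs f

sumN-+ : ∀ xs f g → sumN xs (λ k → f k N.+ g k) ≡ sumN xs f N.+ sumN xs g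
sumN-+ [] f g = refl
sumN-+ (x ∷ xs) f g rewrite sumN-+ xs f g =
  solve 4 (λ a b c d → a :+ b :+ (c :+ d) := a :+ c :+ (b :+ d)) refl (f x) (g x) (sumN xs f) (sumN xs g)
  where open NS.+-*-Solver

sumN-cong : ∀ xs {f g} → (∀ k → f k ≡ g k) → sumN xs f ≡ sumN xs g
sumN-cong [] e = refl
sumN-cong (x ∷ xs) e = cong₂ N._+_ (e x) (sumN-cong xs e)

sumN-indicator : ∀ (p : ℕ → Bool) xs → sumN xs (λ k → if p k then 1 else 0) ≡ countB p xs
sumN-indicator p [] = refl
sumN-indicator p (x ∷ xs) with p x
... | true = cong suc (sumN-indicator p xs)
... | false = sumN-indicator p xs

balls : Word → ℕ
balls = countB (λ e → not (isDash e))

length≡dashes+balls : ∀ w → length w ≡ dashes w N.+ balls w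
length≡dashes+balls [] = refl
length≡dashes+balls (dash ∷ w) = cong suc (length≡dashes+balls w)
length≡dashes+balls (num k ∷ w) = ≡-trans (cong suc (length≡dashes+balls w)) (sym (NP.+-suc (dashes w) (balls w)))

balls≡sumOcc : ∀ b w → allB (inRange b) w ≡ true → balls w ≡ sumN (upTo1 b) (λ k → occ k w)
balls≡sumOcc b [] e = sym (≡-trans (sumN-indicator (λ _ → false) (upTo1 b)) (countB-const-false (upTo1 b)))
balls≡sumOcc b (dash ∷ w) e = balls≡sumOcc b w e
balls≡sumOcc b (num j ∷ w) e = sym (begin
    sumN (upTo1 b) (λ k → occ k (num j ∷ w))
  ≡⟨ sumN-cong (upTo1 b) (λ k → occ-∷ k) ⟩
    sumN (upTo1 b) (λ k → (if does (num j ≟E num k) then 1 else 0) N.+ occ k w)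
  ≡⟨ sumN-+ (upTo1 b) (λ k → if does (num j ≟E num k) then 1 else 0) (λ k → occ k w) ⟩
    sumN (upTo1 b) (λ k → if does (num j ≟E num k) then 1 else 0) N.+ sumN (upTo1 b) (λ k → occ k w)
  ≡⟨ cong₂ N._+_ j-once (sym (balls≡sumOcc b w (∧-elimʳ {inRange b (num j)} e))) ⟩
    suc (balls w)
  ∎)
  where
  open ≡-Reasoning
  j-inRange = ∧-elimˡ {inRange b (num j)} e
  occ-∷ : ∀ k → occ k (num j ∷ w) ≡ (if does (num j ≟E num k) then 1 else 0) N.+ occ k w
  occ-∷ k with does (num j ≟E num k)
  ... | true = refl
  ... | false = refl
  j-once : sumN (upTo1 b) (λ k → if does (num j ≟E num k) then 1 else 0) ≡ 1
  j-once = ≡-trans (sumN-cong (upTo1 b) (λ k → cong (λ z → if z then 1 else 0) (≟E-num-sym j k)))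
    (≡-trans (sumN-indicator (λ k → does (num k ≟E num j)) (upTo1 b)) (countUpTo1 b j (inRange⇒≥1 b j j-inRange) (inRange⇒≤ b j j-inRange)))

validB⇒dashes : ∀ b w → validB b w ≡ true → dashes w ≡ length w N.∸ b
validB⇒dashes b w valid = sym (≡-trans (cong (N._∸ b) (≡-trans (length≡dashes+balls w) (cong (dashes w N.+_) balls≡b)))
                                       (NP.m+n∸n≡m (dashes w) b))
  where
  sumOcc≡length : ∀ (xs : List ℕ) → allB (λ k → occ k w N.≡ᵇ 1) xs ≡ true → sumN xs (λ k → occ k w) ≡ length xs
  sumOcc≡length [] _ = refl
  sumOcc≡length (x ∷ xs) e = cong₂ N._+_ (≡ᵇ1⇒≡1 _ (∧-elimˡ {occ x w N.≡ᵇ 1} e)) (sumOcc≡length xs (∧-elimʳ {occ x w N.≡ᵇ 1} e))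
  balls≡b : balls w ≡ b
  balls≡b = ≡-trans (balls≡sumOcc b w (∧-elimˡ {allB (inRange b) w} valid))
    (≡-trans (sumOcc≡length (upTo1 b) (∧-elimʳ {allB (inRange b) w} valid)) (length-upTo1 b))

validB⇒lacksTop : ∀ b w → validB b w ≡ true → lacksTop b w ≡ true
validB⇒lacksTop b w valid = cong (N._≡ᵇ 0) (≡-trans (countB-congOn {P = inRange b} w (∧-elimˡ {allB (inRange b) w} valid) notTop) (countB-const-false w))
  where
  notTop : ∀ y → inRange b y ≡ true → does (y ≟E num (suc b)) ≡ false
  notTop dash _ = refl
  notTop (num k) iy = ≟E-num-≢ k (suc b) (≤⇒≢suc (inRange⇒≤ b k iy))

validB-suc⇒hasTopOnce : ∀ b w → validB (suc b) w ≡ true → hasTopOnce b w ≡ true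
validB-suc⇒hasTopOnce b w valid = ∧-elimˡ {hasTopOnce b w} (∧-elimʳ {allB (λ k → occ k w N.≡ᵇ 1) (upTo1 b)}
  (≡-trans (sym (allB-++ (λ k → occ k w N.≡ᵇ 1) (upTo1 b) (suc b ∷ []))) (∧-elimʳ {allB (inRange (suc b)) w} valid)))

-- The backward chain as a scan of the reversed word

module _ where
  open +-*-Solver

  neither-selected : ∀ a b K K′ → a * (0ℚ * K) + b * (0ℚ * K′) ≡ 0ℚ
  neither-selected = solve 4 (λ a b K K′ → a :* (con 0ℚ :* K) :+ b :* (con 0ℚ :* K′) := con 0ℚ) refl

  first-selected : ∀ a b K K′ → a * (1ℚ * K) + b * (0ℚ * K′) ≡ a * K
  first-selected = solve 4 (λ a b K K′ → a :* (con 1ℚ :* K) :+ b :* (con 0ℚ :* K′) := a :* K) refl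

  second-selected : ∀ a b K K′ → a * (0ℚ * K) + b * (1ℚ * K′) ≡ b * K′
  second-selected = solve 4 (λ a b K K′ → a :* (con 0ℚ :* K) :+ b :* (con 1ℚ :* K′) := b :* K′) refl

  both-selected-kept : ∀ K → 1ℚ * (1ℚ * K) + 0ℚ * (1ℚ * K) ≡ K
  both-selected-kept = solve 1 (λ K → con 1ℚ :* (con 1ℚ :* K) :+ con 0ℚ :* (con 1ℚ :* K) := K) refl

module _ (h : ℚ) where
  open Chain h using (scale; scan; flipAt; outcomes)

  consOutcome : Entry → ℚ × Word → ℚ × Word
  consOutcome e (p , t) = (p , e ∷ t)

  -- revScan x r: the scan holding x over the cells r, listed from the pointer leftwards;
  -- outcome words list the scanned cells and then the new front cell, also from right to left.
  revScan : Entry → Word → List (ℚ × Word)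
  revScan x [] = (1ℚ , x ∷ []) ∷ []
  revScan x (e ∷ r) = if ltE e x
    then map (scale h) (map (consOutcome e) (revScan x r)) ++ map (scale (1ℚ - h)) (map (consOutcome x) (revScan e r))
    else map (consOutcome e) (revScan x r)

  unreverseOutcome : Word → ℚ × Word → ℚ × Word
  unreverseOutcome suffix (p , t) = (p , reverse t ++ suffix)

  private
    reverse-∷-++ : ∀ (e : Entry) t D → reverse (e ∷ t) ++ D ≡ reverse t ++ e ∷ D
    reverse-∷-++ e t D = ≡-trans (cong (_++ D) (LP.unfold-reverse e t)) (LP.++-assoc (reverse t) (e ∷ []) D)

    unreverse-consOutcome : ∀ e D (K : List (ℚ × Word)) →
      map (unreverseOutcome D) (map (consOutcome e) K) ≡ map (unreverseOutcome (e ∷ D)) K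
    unreverse-consOutcome e D [] = refl
    unreverse-consOutcome e D ((p , t) ∷ K) = cong₂ _∷_ (cong (p ,_) (reverse-∷-++ e t D)) (unreverse-consOutcome e D K)

    unreverse-scale : ∀ c e D (K : List (ℚ × Word)) →
      map (unreverseOutcome D) (map (scale c) (map (consOutcome e) K)) ≡ map (scale c) (map (unreverseOutcome (e ∷ D)) K)
    unreverse-scale c e D [] = refl
    unreverse-scale c e D ((p , t) ∷ K) = cong₂ _∷_ (cong (c * p ,_) (reverse-∷-++ e t D)) (unreverse-scale c e D K)

    take-suc : ∀ k (w : Word) → suc k ≤ length w → take (suc k) w ≡ take k w ++ get w k ∷ []
    take-suc zero (a ∷ w) _ = refl
    take-suc (suc k) (a ∷ w) (s≤s le) = cong (a ∷_) (take-suc k w le)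

    drop-get : ∀ k (w : Word) → suc k ≤ length w → drop k w ≡ get w k ∷ drop (suc k) w
    drop-get zero (a ∷ w) _ = refl
    drop-get (suc k) (a ∷ w) (s≤s le) = drop-get k w le

    take-setAt : ∀ k (w : Word) x → take k (setAt w k x) ≡ take k w
    take-setAt zero w x = refl
    take-setAt (suc k) [] x = refl
    take-setAt (suc k) (a ∷ w) x = cong (a ∷_) (take-setAt k w x)

    drop-setAt : ∀ k (w : Word) x → suc k ≤ length w → drop k (setAt w k x) ≡ x ∷ drop (suc k) w
    drop-setAt zero (a ∷ w) x _ = refl
    drop-setAt (suc k) (a ∷ w) x (s≤s le) = drop-setAt k w x le

    length-setAt : ∀ (w : Word) k x → length (setAt w k x) ≡ length w
    length-setAt [] k x = refl
    length-setAt (a ∷ w) zero x = refl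
    length-setAt (a ∷ w) (suc k) x = cong suc (length-setAt w k x)

  scan≡revScan : ∀ k x (w : Word) → k ≤ length w →
    scan k x w ≡ map (unreverseOutcome (drop k w)) (revScan x (reverse (take k w)))
  scan≡revScan zero x w le = refl
  scan≡revScan (suc k) x w le rewrite take-suc k w le | LP.reverse-++ (take k w) (get w k ∷ []) with ltE (get w k) x
  ... | true = begin
      map (scale h) (scan k x w) ++ map (scale (1ℚ - h)) (scan k e (setAt w k x))
    ≡⟨ cong₂ (λ A B → map (scale h) A ++ map (scale (1ℚ - h)) B) (scan≡revScan k x w k≤) (scan≡revScan k e (setAt w k x) k≤′) ⟩
      map (scale h) (map (unreverseOutcome (drop k w)) K₁)
        ++ map (scale (1ℚ - h)) (map (unreverseOutcome (drop k (setAt w k x))) (revScan e (reverse (take k (setAt w k x)))))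
    ≡⟨ cong₃ (λ A B C → map (scale h) (map (unreverseOutcome A) K₁)
                         ++ map (scale (1ℚ - h)) (map (unreverseOutcome B) (revScan e (reverse C))))
             (drop-get k w le) (drop-setAt k w x le) (take-setAt k w x) ⟩
      map (scale h) (map (unreverseOutcome (e ∷ D)) K₁) ++ map (scale (1ℚ - h)) (map (unreverseOutcome (x ∷ D)) K₂)
    ≡⟨ sym (cong₂ _++_ (unreverse-scale h e D K₁) (unreverse-scale (1ℚ - h) x D K₂)) ⟩
      map (unreverseOutcome D) (map (scale h) (map (consOutcome e) K₁))
        ++ map (unreverseOutcome D) (map (scale (1ℚ - h)) (map (consOutcome x) K₂))
    ≡⟨ sym (LP.map-++ (unreverseOutcome D) (map (scale h) (map (consOutcome e) K₁)) (map (scale (1ℚ - h)) (map (consOutcome x) K₂))) ⟩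
      map (unreverseOutcome D) (map (scale h) (map (consOutcome e) K₁) ++ map (scale (1ℚ - h)) (map (consOutcome x) K₂))
    ∎
    where
    open ≡-Reasoning
    e = get w k
    D = drop (suc k) w
    K₁ = revScan x (reverse (take k w))
    K₂ = revScan e (reverse (take k w))
    k≤ : k ≤ length w
    k≤ = NP.≤-trans (NP.n≤1+n k) le
    k≤′ : k ≤ length (setAt w k x)
    k≤′ = NP.≤-trans k≤ (NP.≤-reflexive (sym (length-setAt w k x)))
    cong₃ : {A B C R : Set} (f : A → B → C → R) {a a' : A} {b b' : B} {c c' : C} → a ≡ a' → b ≡ b' → c ≡ c' → f a b c ≡ f a' b' c'
    cong₃ f refl refl refl = refl
  ... | false =
    ≡-trans (scan≡revScan k x w (NP.≤-trans (NP.n≤1+n k) le))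
    (≡-trans (cong (λ D → map (unreverseOutcome D) (revScan x (reverse (take k w)))) (drop-get k w le))
    (sym (unreverse-consOutcome (get w k) (drop (suc k) w) _)))

  outcomes≡revScan : ∀ τ t j → trim τ ≡ t ++ num j ∷ [] →
    outcomes τ ≡ map (unreverseOutcome []) (revScan dash (reverse (trim τ)))
  outcomes≡revScan τ t j e rewrite e =
    ≡-trans startAtEnd (≡-trans (scan≡revScan (length u) dash u NP.≤-refl)
      (cong₂ (λ A B → map (unreverseOutcome A) (revScan dash (reverse B)))
        (LP.drop-all (length u) u NP.≤-refl) (LP.take-all (length u) u NP.≤-refl)))
    where
    u = t ++ num j ∷ []
    get-last : ∀ (t : Word) a → get (t ++ a ∷ []) (length t) ≡ a
    get-last [] a = refl
    get-last (x ∷ t) a = get-last t a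
    length-u : length u ≡ suc (length t)
    length-u = ≡-trans (LP.length-++ t) (NP.+-comm (length t) 1)
    startAtEnd : flipAt (length u N.∸ 1) dash u ≡ scan (length u) dash u
    startAtEnd rewrite length-u | get-last t (num j) = refl

  keepProb swapProb : Entry → Entry → ℚ
  keepProb e x = if ltE e x then h else 1ℚ
  swapProb e x = if ltE e x then 1ℚ - h else 0ℚ

  outcomeMean : List (ℚ × Word) → (Word → ℚ) → ℚ
  outcomeMean K g = sumL K (λ o → g (proj₂ o) * proj₁ o)

  revScanMean : Entry → Word → (Word → ℚ) → ℚ
  revScanMean x r = outcomeMean (revScan x r)

  outcomeMean-consOutcome : ∀ e K (g : Word → ℚ) → outcomeMean (map (consOutcome e) K) g ≡ outcomeMean K (λ t → g (e ∷ t))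
  outcomeMean-consOutcome e K g = sumL-map K (consOutcome e) (λ o → g (proj₂ o) * proj₁ o)

  outcomeMean-scale : ∀ c K (g : Word → ℚ) → outcomeMean (map (scale c) K) g ≡ c * outcomeMean K g
  outcomeMean-scale c K g =
    ≡-trans (sumL-map K (scale c) (λ o → g (proj₂ o) * proj₁ o))
    (≡-trans (sumL-cong K (λ o → commute (g (proj₂ o)) c (proj₁ o))) (sumL-*ˡ K c (λ o → g (proj₂ o) * proj₁ o)))
    where
    open +-*-Solver
    commute : ∀ a c p → a * (c * p) ≡ c * (a * p)
    commute = solve 3 (λ a c p → a :* (c :* p) := c :* (a :* p)) refl

  revScanMean-∷ : ∀ x e r g → revScanMean x (e ∷ r) g ≡
    keepProb e x * revScanMean x r (λ t → g (e ∷ t)) + swapProb e x * revScanMean e r (λ t → g (x ∷ t))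
  revScanMean-∷ x e r g with ltE e x
  ... | true = ≡-trans (sumL-++ (map (scale h) (map (consOutcome e) (revScan x r))) _ _)
      (cong₂ _+_ (≡-trans (outcomeMean-scale h (map (consOutcome e) (revScan x r)) g) (cong (h *_) (outcomeMean-consOutcome e (revScan x r) g)))
                 (≡-trans (outcomeMean-scale (1ℚ - h) (map (consOutcome x) (revScan e r)) g) (cong ((1ℚ - h) *_) (outcomeMean-consOutcome x (revScan e r) g))))
  ... | false = ≡-trans (outcomeMean-consOutcome e (revScan x r) g)
      (solve 2 (λ M M' → M := con 1ℚ :* M :+ con 0ℚ :* M') refl (revScanMean x r (λ t → g (e ∷ t))) (revScanMean e r (λ t → g (x ∷ t))))
    where open +-*-Solver

  revScanMean-cong : ∀ x r {g g' : Word → ℚ} → (∀ u → g u ≡ g' u) → revScanMean x r g ≡ revScanMean x r g'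
  revScanMean-cong x r e = sumL-cong (revScan x r) (λ o → cong (_* proj₁ o) (e (proj₂ o)))

  revScanMean-congLength : ∀ x r {g g' : Word → ℚ} → (∀ u → length u ≡ suc (length r) → g u ≡ g' u) →
    revScanMean x r g ≡ revScanMean x r g'
  revScanMean-congLength x [] e = cong (λ z → z * 1ℚ + 0ℚ) (e (x ∷ []) refl)
  revScanMean-congLength x (e' ∷ r) {g} {g'} e = ≡-trans (revScanMean-∷ x e' r g) (≡-trans
    (cong₂ _+_ (cong (keepProb e' x *_) (revScanMean-congLength x r (λ u lu → e (e' ∷ u) (cong suc lu))))
               (cong (swapProb e' x *_) (revScanMean-congLength e' r (λ u lu → e (x ∷ u) (cong suc lu)))))
    (sym (revScanMean-∷ x e' r g')))

  revScanMean-*ˡ : ∀ x r c (g : Word → ℚ) → revScanMean x r (λ u → c * g u) ≡ c * revScanMean x r g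
  revScanMean-*ˡ x r c g = ≡-trans (sumL-cong (revScan x r) (λ o → QP.*-assoc c (g (proj₂ o)) (proj₁ o))) (sumL-*ˡ (revScan x r) c _)

  revScanMean-leadingDashes : ∀ k r g → revScanMean dash (replicate k dash ++ r) g ≡ revScanMean dash r (λ u → g (replicate k dash ++ u))
  revScanMean-leadingDashes zero r g = refl
  revScanMean-leadingDashes (suc k) r g = ≡-trans (revScanMean-∷ dash dash (replicate k dash ++ r) g)
    (≡-trans (solve 2 (λ M M' → con 1ℚ :* M :+ con 0ℚ :* M' := M) refl
               (revScanMean dash (replicate k dash ++ r) (λ t → g (dash ∷ t))) (revScanMean dash (replicate k dash ++ r) (λ t → g (dash ∷ t))))
             (revScanMean-leadingDashes k r (λ t → g (dash ∷ t))))
    where open +-*-Solver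

  revScanProb : Entry → Word → Word → ℚ
  revScanProb x [] [] = 0ℚ
  revScanProb x [] (c ∷ []) = 𝟙 (does (x ≟E c))
  revScanProb x [] (c ∷ d ∷ t) = 0ℚ
  revScanProb x (e ∷ r) [] = 0ℚ
  revScanProb x (e ∷ r) (c ∷ t) =
    keepProb e x * (𝟙 (does (e ≟E c)) * revScanProb x r t) + swapProb e x * (𝟙 (does (x ≟E c)) * revScanProb e r t)

  private
    ≟W-∷ : ∀ x xs y ys → does ((x ∷ xs) ≟W (y ∷ ys)) ≡ (does (x ≟E y) ∧ does (xs ≟W ys))
    ≟W-∷ x xs y ys with x ≟E y | xs ≟W ys
    ... | yes refl | yes refl = refl
    ... | yes refl | no _ = refl
    ... | no _ | yes _ = refl
    ... | no _ | no _ = refl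

    ∧-falseʳ : ∀ a → (a ∧ false) ≡ false
    ∧-falseʳ true = refl
    ∧-falseʳ false = refl

  revScanMean-indicator : ∀ x r t → revScanMean x r (λ u → 𝟙 (does (u ≟W t))) ≡ revScanProb x r t
  revScanMean-indicator x [] [] = refl
  revScanMean-indicator x [] (c ∷ []) =
    ≡-trans (cong (λ z → 𝟙 z * 1ℚ + 0ℚ) (≡-trans (≟W-∷ x [] c []) (∧-trueʳ _))) (solve 1 (λ z → z :* con 1ℚ :+ con 0ℚ := z) refl (𝟙 (does (x ≟E c))))
    where open +-*-Solver
  revScanMean-indicator x [] (c ∷ d ∷ t) = cong (λ z → 𝟙 z * 1ℚ + 0ℚ) (≡-trans (≟W-∷ x [] c (d ∷ t)) (∧-falseʳ _))
  revScanMean-indicator x (e ∷ r) [] = ≡-trans (revScanMean-∷ x e r (λ u → 𝟙 (does (u ≟W []))))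
    (≡-trans (cong₂ (λ A B → keepProb e x * A + swapProb e x * B) (sumL-zero′ (revScan x r)) (sumL-zero′ (revScan e r)))
    (solve 2 (λ a b → a :* con 0ℚ :+ b :* con 0ℚ := con 0ℚ) refl (keepProb e x) (swapProb e x)))
    where
    open +-*-Solver
    sumL-zero′ : (K : List (ℚ × Word)) → outcomeMean K (λ _ → 0ℚ) ≡ 0ℚ
    sumL-zero′ K = ≡-trans (sumL-cong K (λ o → QP.*-zeroˡ (proj₁ o))) (sumL-zero K)
  revScanMean-indicator x (e ∷ r) (c ∷ t) = ≡-trans (revScanMean-∷ x e r (λ u → 𝟙 (does (u ≟W (c ∷ t)))))
    (cong₂ (λ A B → keepProb e x * A + swapProb e x * B) (peel x e) (peel e x))
    where
    peel : ∀ y z → revScanMean y r (λ u → 𝟙 (does ((z ∷ u) ≟W (c ∷ t)))) ≡ 𝟙 (does (z ≟E c)) * revScanProb y r t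
    peel y z = ≡-trans (revScanMean-cong y r (λ u → ≡-trans (cong 𝟙 (≟W-∷ z u c t)) (𝟙-∧ (does (z ≟E c)) _)))
               (≡-trans (revScanMean-*ˡ y r (𝟙 (does (z ≟E c))) (λ u → 𝟙 (does (u ≟W t)))) (cong (𝟙 (does (z ≟E c)) *_) (revScanMean-indicator y r t)))

  revScanProb≡0⊎↭ : ∀ x r t → (revScanProb x r t ≡ 0ℚ) ⊎ ((x ∷ r) ↭ t)
  revScanProb≡0⊎↭ x [] [] = inj₁ refl
  revScanProb≡0⊎↭ x [] (c ∷ []) with x ≟E c
  ... | yes refl = inj₂ Perm.refl
  ... | no _ = inj₁ refl
  revScanProb≡0⊎↭ x [] (c ∷ d ∷ t) = inj₁ refl
  revScanProb≡0⊎↭ x (e ∷ r) [] = inj₁ refl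
  revScanProb≡0⊎↭ x (e ∷ r) (c ∷ t) with e ≟E c | x ≟E c
  ... | no _ | no _ = inj₁ (neither-selected (keepProb e x) (swapProb e x) (revScanProb x r t) (revScanProb e r t))
  ... | yes refl | no _ with revScanProb≡0⊎↭ x r t
  ...   | inj₁ z = inj₁ (≡-trans (first-selected (keepProb e x) (swapProb e x) (revScanProb x r t) (revScanProb e r t))
                             (≡-trans (cong (keepProb e x *_) z) (QP.*-zeroʳ (keepProb e x))))
  ...   | inj₂ p = inj₂ (Perm.trans (Perm.swap x e Perm.refl) (Perm.prep e p))
  revScanProb≡0⊎↭ x (e ∷ r) (c ∷ t) | no _ | yes refl with revScanProb≡0⊎↭ e r t
  ...   | inj₁ z = inj₁ (≡-trans (second-selected (keepProb e x) (swapProb e x) (revScanProb x r t) (revScanProb e r t))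
                             (≡-trans (cong (swapProb e x *_) z) (QP.*-zeroʳ (swapProb e x))))
  ...   | inj₂ p = inj₂ (Perm.prep x p)
  revScanProb≡0⊎↭ x (e ∷ r) (c ∷ t) | yes refl | yes refl with revScanProb≡0⊎↭ x r t
  ...   | inj₁ z rewrite ltE-irrefl x | z = inj₁ (both-selected-kept 0ℚ)
  ...   | inj₂ p = inj₂ (Perm.prep x p)

  powℚ-+ : ∀ m n → powℚ h (m N.+ n) ≡ powℚ h m * powℚ h n
  powℚ-+ zero n = sym (QP.*-identityˡ _)
  powℚ-+ (suc m) n = ≡-trans (cong (h *_) (powℚ-+ m n)) (sym (QP.*-assoc h (powℚ h m) (powℚ h n)))

  weight : Word → ℚ
  weight s = powℚ h (revInversions s)

  -- The output starting with c arises by passing over c or by swapping x for c; the two weights add up.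
  weight-localBalance : ∀ r x c →
    weight (x ∷ c ∷ r) * keepProb c x + weight (c ∷ x ∷ r) * swapProb x c ≡ powℚ h (revInversions (x ∷ r) N.+ countAbove (x ∷ r) c)
  weight-localBalance r x c = balance (revInversions r) (countAbove r x) (countAbove r c) (ltE x c) (ltE c x) (ltE-asym x c)
    where
    open +-*-Solver
    balance : ∀ A gx gc (x<c c<x : Bool) → (x<c ≡ true → c<x ≡ false) →
      powℚ h (A N.+ gc N.+ (if x<c then suc gx else gx)) * (if c<x then h else 1ℚ)
        + powℚ h (A N.+ gx N.+ (if c<x then suc gc else gc)) * (if x<c then 1ℚ - h else 0ℚ)
      ≡ powℚ h (A N.+ gx N.+ (if c<x then suc gc else gc))
    balance A gx gc true true asym with asym refl
    ... | ()
    balance A gx gc true false _ rewrite NP.+-suc (A N.+ gc) gx | ℕ+.xy∙z≈xz∙y A gc gx =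
      solve 2 (λ h P → h :* P :* con 1ℚ :+ P :* (con 1ℚ :- h) := P) refl h (powℚ h (A N.+ gx N.+ gc))
    balance A gx gc false true _ rewrite NP.+-suc (A N.+ gx) gc | ℕ+.xy∙z≈xz∙y A gc gx =
      solve 2 (λ h P → P :* h :+ h :* P :* con 0ℚ := h :* P) refl h (powℚ h (A N.+ gx N.+ gc))
    balance A gx gc false false _ rewrite ℕ+.xy∙z≈xz∙y A gc gx =
      solve 1 (λ P → P :* con 1ℚ :+ P :* con 0ℚ := P) refl (powℚ h (A N.+ gx N.+ gc))

  -- A nonzero revScanProb x r t forces x ∷ r ↭ t, so entries above c may be counted in t instead.
  weight-countAbove : ∀ x r t c →
    powℚ h (revInversions (x ∷ r) N.+ countAbove (x ∷ r) c) * revScanProb x r t ≡ weight (x ∷ r) * revScanProb x r t * powℚ h (countAbove t c)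
  weight-countAbove x r t c with revScanProb≡0⊎↭ x r t
  ... | inj₁ z rewrite z = ≡-trans (QP.*-zeroʳ (powℚ h (revInversions (x ∷ r) N.+ countAbove (x ∷ r) c)))
    (sym (≡-trans (cong (_* powℚ h (countAbove t c)) (QP.*-zeroʳ (weight (x ∷ r)))) (QP.*-zeroˡ (powℚ h (countAbove t c)))))
  ... | inj₂ p rewrite powℚ-+ (revInversions (x ∷ r)) (countAbove (x ∷ r) c) | countB-↭ (λ y → gtE y c) p =
    solve 3 (λ A B K → A :* B :* K := A :* K :* B) refl (weight (x ∷ r)) (powℚ h (countAbove t c)) (revScanProb x r t)
    where open +-*-Solver

  revScanProb-balance-∷ : ∀ b r c t → count c (letters b) ≡ 1 →
    sumL (letters b) (λ e → sumL (letters b) (λ x → weight (x ∷ e ∷ r) * revScanProb x (e ∷ r) (c ∷ t)))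
      ≡ sumL (letters b) (λ x → weight (x ∷ r) * revScanProb x r t) * powℚ h (countAbove t c)
  revScanProb-balance-∷ b r c t c-once = begin
      sumL L (λ e → sumL L (λ x → weight (x ∷ e ∷ r) * revScanProb x (e ∷ r) (c ∷ t)))
    ≡⟨ sumL-cong L (λ e → sumL-cong L (λ x → distribute (weight (x ∷ e ∷ r)) (keepProb e x) (δ e) (K x) (swapProb e x) (δ x) (K e))) ⟩
      sumL L (λ e → sumL L (λ x → δ e * P e x + δ x * Q e x))
    ≡⟨ sumL-cong L (λ e → sumL-+ L (λ x → δ e * P e x) (λ x → δ x * Q e x)) ⟩
      sumL L (λ e → sumL L (λ x → δ e * P e x) + sumL L (λ x → δ x * Q e x))
    ≡⟨ sumL-+ L (λ e → sumL L (λ x → δ e * P e x)) (λ e → sumL L (λ x → δ x * Q e x)) ⟩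
      sumL L (λ e → sumL L (λ x → δ e * P e x)) + sumL L (λ e → sumL L (λ x → δ x * Q e x))
    ≡⟨ cong₂ _+_ (≡-trans (sumL-cong L (λ e → sumL-*ˡ L (δ e) (P e))) (sumL-δ-once c L (λ e → sumL L (P e)) c-once))
                 (sumL-cong L (λ e → sumL-δ-once c L (Q e) c-once)) ⟩
      sumL L (P c) + sumL L (λ x → Q x c)
    ≡⟨ sym (sumL-+ L (P c) (λ x → Q x c)) ⟩
      sumL L (λ x → P c x + Q x c)
    ≡⟨ sumL-cong L (λ x → factor (weight (x ∷ c ∷ r)) (keepProb c x) (K x) (weight (c ∷ x ∷ r)) (swapProb x c)) ⟩
      sumL L (λ x → (weight (x ∷ c ∷ r) * keepProb c x + weight (c ∷ x ∷ r) * swapProb x c) * K x)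
    ≡⟨ sumL-cong L (λ x → ≡-trans (cong (_* K x) (weight-localBalance r x c)) (weight-countAbove x r t c)) ⟩
      sumL L (λ x → weight (x ∷ r) * K x * powℚ h (countAbove t c))
    ≡⟨ sumL-*ʳ L (powℚ h (countAbove t c)) (λ x → weight (x ∷ r) * K x) ⟩
      sumL L (λ x → weight (x ∷ r) * K x) * powℚ h (countAbove t c)
    ∎
    where
    open ≡-Reasoning
    open +-*-Solver
    L = letters b
    δ : Entry → ℚ
    δ e = 𝟙 (does (e ≟E c))
    K : Entry → ℚ
    K x = revScanProb x r t
    P Q : Entry → Entry → ℚ
    P e x = weight (x ∷ e ∷ r) * keepProb e x * K x
    Q e x = weight (x ∷ e ∷ r) * swapProb e x * K e
    distribute : ∀ W a d K₁ s d′ K₂ → W * (a * (d * K₁) + s * (d′ * K₂)) ≡ d * (W * a * K₁) + d′ * (W * s * K₂)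
    distribute = solve 7 (λ W a d K₁ s d′ K₂ → W :* (a :* (d :* K₁) :+ s :* (d′ :* K₂)) := d :* (W :* a :* K₁) :+ d′ :* (W :* s :* K₂)) refl
    factor : ∀ W a K W′ s → W * a * K + W′ * s * K ≡ (W * a + W′ * s) * K
    factor = solve 5 (λ W a K W′ s → W :* a :* K :+ W′ :* s :* K := (W :* a :+ W′ :* s) :* K) refl

  revScanProb-balance : ∀ b n t → length t ≡ suc n → All (λ c → count c (letters b) ≡ 1) t →
    sumL (allWords b n) (λ r → sumL (letters b) (λ x → weight (x ∷ r) * revScanProb x r t)) ≡ weight t
  revScanProb-balance b zero (c ∷ []) _ (c-once ∷ []) =
    ≡-trans (QP.+-identityʳ _) (≡-trans (sumL-cong (letters b) (λ x → QP.*-comm 1ℚ (𝟙 (does (x ≟E c)))))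
      (sumL-δ-once c (letters b) (λ _ → 1ℚ) c-once))
  revScanProb-balance b (suc n) (c ∷ t) length-t (c-once ∷ t-once) = begin
      sumL (allWords b (suc n)) (λ r → sumL L (λ x → weight (x ∷ r) * revScanProb x r (c ∷ t)))
    ≡⟨ sumWords-∷ b n _ ⟩
      sumL (allWords b n) (λ r → sumL L (λ e → sumL L (λ x → weight (x ∷ e ∷ r) * revScanProb x (e ∷ r) (c ∷ t))))
    ≡⟨ sumL-cong (allWords b n) (λ r → revScanProb-balance-∷ b r c t c-once) ⟩
      sumL (allWords b n) (λ r → sumL L (λ x → weight (x ∷ r) * revScanProb x r t) * powℚ h (countAbove t c))
    ≡⟨ sumL-*ʳ (allWords b n) (powℚ h (countAbove t c)) _ ⟩
      sumL (allWords b n) (λ r → sumL L (λ x → weight (x ∷ r) * revScanProb x r t)) * powℚ h (countAbove t c)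
    ≡⟨ cong (_* powℚ h (countAbove t c)) (revScanProb-balance b n t (NP.suc-injective length-t) t-once) ⟩
      weight t * powℚ h (countAbove t c)
    ≡⟨ sym (powℚ-+ (revInversions t) (countAbove t c)) ⟩
      weight (c ∷ t)
    ∎
    where
    open ≡-Reasoning
    L = letters b

  validWeight : ℕ → Word → ℚ
  validWeight b w = 𝟙 (validB b w) * powℚ h (inversions w)

  partitionSum : ℕ → ℕ → ℚ
  partitionSum b N = sumL (allWords b N) (validWeight b)

  geomSum : ℕ → ℚ
  geomSum zero = 0ℚ
  geomSum (suc m) = 1ℚ + h * geomSum m

  partitionProduct : ℕ → ℕ → ℚ
  partitionProduct zero N = 1ℚ
  partitionProduct (suc b) N = geomSum (N N.∸ b) * partitionProduct b N

  -- Putting the top ball on the k-th dash of w (from the left, counting from 0) adds k inversions.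
  sumReplaceDash-validWeight : ∀ b pre w → occ (suc b) (pre ++ w) ≡ 0 →
    sumReplaceDash (suc b) (λ x → validWeight (suc b) (pre ++ x)) w ≡ validWeight b (pre ++ w) * powℚ h (dashes pre) * geomSum (dashes w)
  sumReplaceDash-validWeight b pre [] z = sym (QP.*-zeroʳ (validWeight b (pre ++ []) * powℚ h (dashes pre)))
  sumReplaceDash-validWeight b pre (dash ∷ w) z =
    ≡-trans (cong₂ _+_ (cong (λ v → 𝟙 v * powℚ h (inversions (pre ++ num (suc b) ∷ w))) (validB-replaceDash b pre w z)) shiftDash)
    (combine (validB b (pre ++ dash ∷ w)) refl)
    where
    open +-*-Solver
    pre′ = pre ++ dash ∷ []
    shiftDash : sumReplaceDash (suc b) (λ x → validWeight (suc b) (pre ++ dash ∷ x)) w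
              ≡ validWeight b (pre ++ dash ∷ w) * powℚ h (suc (dashes pre)) * geomSum (dashes w)
    shiftDash =
      ≡-trans (sumReplaceDash-cong (suc b) w (λ x → cong (validWeight (suc b)) (sym (LP.++-assoc pre (dash ∷ []) x))))
      (≡-trans (sumReplaceDash-validWeight b pre′ w (≡-trans (cong (occ (suc b)) (LP.++-assoc pre (dash ∷ []) w)) z))
      (cong₂ (λ A n → validWeight b A * powℚ h n * geomSum (dashes w)) (LP.++-assoc pre (dash ∷ []) w)
             (≡-trans (countB-++ isDash pre (dash ∷ [])) (NP.+-comm (dashes pre) 1))))
    combine : ∀ v → validB b (pre ++ dash ∷ w) ≡ v →
      𝟙 v * powℚ h (inversions (pre ++ num (suc b) ∷ w)) + 𝟙 v * powℚ h (inversions (pre ++ dash ∷ w)) * powℚ h (suc (dashes pre)) * geomSum (dashes w)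
      ≡ 𝟙 v * powℚ h (inversions (pre ++ dash ∷ w)) * powℚ h (dashes pre) * geomSum (suc (dashes w))
    combine false _ = solve 6 (λ X Y Z W U H → con 0ℚ :* X :+ con 0ℚ :* Y :* Z :* W := con 0ℚ :* Y :* U :* (con 1ℚ :+ H :* W)) refl
      (powℚ h (inversions (pre ++ num (suc b) ∷ w))) (powℚ h (inversions (pre ++ dash ∷ w))) (powℚ h (suc (dashes pre)))
      (geomSum (dashes w)) (powℚ h (dashes pre)) h
    combine true valid rewrite inversions-replaceDash b pre w (∧-elimˡ valid) | powℚ-+ (inversions (pre ++ dash ∷ w)) (dashes pre) =
      solve 4 (λ I D H G → con 1ℚ :* (I :* D) :+ con 1ℚ :* I :* (H :* D) :* G := con 1ℚ :* I :* D :* (con 1ℚ :+ H :* G)) refl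
        (powℚ h (inversions (pre ++ dash ∷ w))) (powℚ h (dashes pre)) h (geomSum (dashes w))
  sumReplaceDash-validWeight b pre (num k ∷ w) z =
    ≡-trans (sumReplaceDash-cong (suc b) w (λ x → cong (validWeight (suc b)) (sym (LP.++-assoc pre (num k ∷ []) x))))
    (≡-trans (sumReplaceDash-validWeight b (pre ++ num k ∷ []) w (≡-trans (cong (occ (suc b)) (LP.++-assoc pre (num k ∷ []) w)) z))
    (cong₂ (λ A n → validWeight b A * powℚ h n * geomSum (dashes w)) (LP.++-assoc pre (num k ∷ []) w)
           (≡-trans (countB-++ isDash pre (num k ∷ [])) (NP.+-identityʳ (dashes pre)))))

  partitionSum-suc : ∀ b N → partitionSum (suc b) N ≡ partitionSum b N * geomSum (N N.∸ b)
  partitionSum-suc b N = begin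
      sumL (allWords (suc b) N) (validWeight (suc b))
    ≡⟨ sumL-cong W′ (λ w → hasTopOnce-factor w (validB (suc b) w) refl) ⟩
      sumL W′ (λ w → 𝟙 (hasTopOnce b w) * validWeight (suc b) w)
    ≡⟨ sumWords-hasTopOnce b N (validWeight (suc b)) ⟩
      sumL W′ (λ w → 𝟙 (lacksTop b w) * sumReplaceDash (suc b) (validWeight (suc b)) w)
    ≡⟨ sumL-cong W′ (λ w → insertTop w (lacksTop b w) refl) ⟩
      sumL W′ (λ w → 𝟙 (lacksTop b w) * (validWeight b w * geomSum (dashes w)))
    ≡⟨ sumWords-lacksTop b N _ ⟩
      sumL (allWords b N) (λ w → 𝟙 (lacksTop b w) * (validWeight b w * geomSum (dashes w)))
    ≡⟨ sumWords-cong b N (λ w length-w → freeSlots w length-w (validB b w) refl) ⟩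
      sumL (allWords b N) (λ w → validWeight b w * geomSum (N N.∸ b))
    ≡⟨ sumL-*ʳ (allWords b N) (geomSum (N N.∸ b)) (validWeight b) ⟩
      partitionSum b N * geomSum (N N.∸ b)
    ∎
    where
    open ≡-Reasoning
    open +-*-Solver
    W′ = allWords (suc b) N
    hasTopOnce-factor : ∀ w v → validB (suc b) w ≡ v → 𝟙 v * powℚ h (inversions w) ≡ 𝟙 (hasTopOnce b w) * (𝟙 v * powℚ h (inversions w))
    hasTopOnce-factor w true valid rewrite validB-suc⇒hasTopOnce b w valid = sym (QP.*-identityˡ _)
    hasTopOnce-factor w false _ = solve 2 (λ t P → con 0ℚ :* P := t :* (con 0ℚ :* P)) refl (𝟙 (hasTopOnce b w)) (powℚ h (inversions w))
    insertTop : ∀ w v → lacksTop b w ≡ v →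
      𝟙 v * sumReplaceDash (suc b) (validWeight (suc b)) w ≡ 𝟙 v * (validWeight b w * geomSum (dashes w))
    insertTop w true noTop = cong (1ℚ *_) (≡-trans (sumReplaceDash-validWeight b [] w (≡ᵇ0⇒≡0 _ noTop))
      (cong (_* geomSum (dashes w)) (QP.*-identityʳ (validWeight b w))))
    insertTop w false _ = ≡-trans (QP.*-zeroˡ (sumReplaceDash (suc b) (validWeight (suc b)) w)) (sym (QP.*-zeroˡ (validWeight b w * geomSum (dashes w))))
    freeSlots : ∀ w → length w ≡ N → ∀ v → validB b w ≡ v →
      𝟙 (lacksTop b w) * (𝟙 v * powℚ h (inversions w) * geomSum (dashes w)) ≡ 𝟙 v * powℚ h (inversions w) * geomSum (N N.∸ b)
    freeSlots w length-w true valid rewrite validB⇒lacksTop b w valid | validB⇒dashes b w valid | length-w = QP.*-identityˡ _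
    freeSlots w length-w false _ = solve 4 (λ t P G G′ → t :* (con 0ℚ :* P :* G) := con 0ℚ :* P :* G′) refl
      (𝟙 (lacksTop b w)) (powℚ h (inversions w)) (geomSum (dashes w)) (geomSum (N N.∸ b))

  partitionSum≡partitionProduct : ∀ b N → partitionSum b N ≡ partitionProduct b N
  partitionSum≡partitionProduct zero N =
    ≡-trans (sumWords-0 N (validWeight 0))
    (≡-trans (cong₂ (λ A n → 𝟙 (A ∧ true) * powℚ h n) (noBalls N) (inversions-padDashes [] N)) (QP.*-identityˡ 1ℚ))
    where
    noBalls : ∀ N → allB (inRange 0) (replicate N dash) ≡ true
    noBalls zero = refl
    noBalls (suc N) = noBalls N
  partitionSum≡partitionProduct (suc b) N =
    ≡-trans (partitionSum-suc b N)
    (≡-trans (cong (_* geomSum (N N.∸ b)) (partitionSum≡partitionProduct b N)) (QP.*-comm (partitionProduct b N) (geomSum (N N.∸ b))))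

  trans≡revScanMean : ∀ τ σ → (Σ Word λ t → Σ ℕ (λ j → trim τ ≡ t ++ num j ∷ [])) →
    trans h (trim τ) σ ≡ revScanMean dash (reverse (trim τ)) (λ u → 𝟙 (does (trim (reverse u) ≟W σ)))
  trans≡revScanMean τ σ (t , j , τ-ends) =
    ≡-trans (sumℚ-map (filter isσ (outcomes (trim τ))) proj₁)
    (≡-trans (sumL-filter isσ (outcomes (trim τ)) proj₁)
    (≡-trans (cong (λ l → sumL l (λ o → if does (isσ o) then proj₁ o else 0ℚ))
                   (≡-trans (outcomes≡revScan (trim τ) t j (≡-trans (trim-idempotent τ) τ-ends))
                            (cong (λ z → map (unreverseOutcome []) (revScan dash (reverse z))) (trim-idempotent τ))))
    (≡-trans (sumL-map (revScan dash (reverse (trim τ))) (unreverseOutcome []) (λ o → if does (isσ o) then proj₁ o else 0ℚ))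
    (sumL-cong (revScan dash (reverse (trim τ))) (λ o → ≡-trans (if-then-0≡𝟙* _ (proj₁ o))
      (cong (λ z → 𝟙 (does (trim z ≟W σ)) * proj₁ o) (LP.++-identityʳ (reverse (proj₂ o)))))))))
    where
    isσ : (o : ℚ × Word) → Dec (trim (proj₂ o) ≡ σ)
    isσ o = trim (proj₂ o) ≟W σ

  -- A state τ inside the window [0, N) is padded to the length-N word w; the chain's outcomes
  -- then have length N + 1, so σ is matched through its padding to length N + 1.
  trans≡revScanProb : ∀ b N w σ → 1 ≤ b → length w ≡ N → validB b w ≡ true → trim σ ≡ σ →
    trans h (trim w) σ ≡ revScanProb dash (reverse w) (reverse (padTo (suc N) σ))
  trans≡revScanProb b N w σ 1≤b length-w valid trim-σ with trim-endsInNum w | trim-padding w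
  ... | inj₁ trim≡[] | _ = ⊥-elim (trim-nonEmpty b w 1≤b valid trim≡[])
  ... | inj₂ ends | k , w≡ = begin
      trans h (trim w) σ
    ≡⟨ trans≡revScanMean w σ ends ⟩
      revScanMean dash (reverse (trim w)) g
    ≡⟨ revScanMean-cong dash (reverse (trim w)) (λ u → sym (g-padDashes u)) ⟩
      revScanMean dash (reverse (trim w)) (λ u → g (replicate k dash ++ u))
    ≡⟨ sym (revScanMean-leadingDashes k (reverse (trim w)) g) ⟩
      revScanMean dash (replicate k dash ++ reverse (trim w)) g
    ≡⟨ cong (λ r → revScanMean dash r g) (sym reverse-w) ⟩
      revScanMean dash (reverse w) g
    ≡⟨ revScanMean-congLength dash (reverse w) g≡indicator ⟩
      revScanMean dash (reverse w) (λ u → 𝟙 (does (u ≟W t)))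
    ≡⟨ revScanMean-indicator dash (reverse w) t ⟩
      revScanProb dash (reverse w) t
    ∎
    where
    open ≡-Reasoning
    t = reverse (padTo (suc N) σ)
    g : Word → ℚ
    g u = 𝟙 (does (trim (reverse u) ≟W σ))
    reverse-w : reverse w ≡ replicate k dash ++ reverse (trim w)
    reverse-w = ≡-trans (cong reverse w≡) (≡-trans (LP.reverse-++ (trim w) (replicate k dash)) (cong (_++ reverse (trim w)) (reverse-replicate k dash)))
    g-padDashes : ∀ u → g (replicate k dash ++ u) ≡ g u
    g-padDashes u = cong (λ z → 𝟙 (does (z ≟W σ)))
      (≡-trans (cong trim (≡-trans (LP.reverse-++ (replicate k dash) u) (cong (reverse u ++_) (reverse-replicate k dash))))
               (trim-padDashes (reverse u) k))
    g≡indicator : ∀ u → length u ≡ suc (length (reverse w)) → g u ≡ 𝟙 (does (u ≟W t))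
    g≡indicator u length-u =
      cong 𝟙 (does-trim-reverse≟ (suc N) σ u trim-σ (≡-trans length-u (cong suc (≡-trans (LP.length-reverse w) length-w))))

  ballStartMass : ℕ → ℕ → Word → ℚ
  ballStartMass b N t = sumL (allWords b N) (λ r → sumL (map num (upTo1 b)) (λ x → weight (x ∷ r) * revScanProb x r t))

  flowTerm≡dashScan : ∀ b N σ w → 1 ≤ b → validB b σ ≡ true → trim σ ≡ σ → length w ≡ N →
    𝟙 (validB b w) * (piDist h b (trim w) * trans h (trim w) σ)
      ≡ powℚ (1ℚ - h) b * (weight (dash ∷ reverse w) * revScanProb dash (reverse w) (reverse (padTo (suc N) σ)))
  flowTerm≡dashScan b N σ w 1≤b valid-σ trim-σ length-w with validB b w in valid-w
  ... | true rewrite trans≡revScanProb b N w σ 1≤b length-w valid-w trim-σ | inversions-trim w | revInversions-dash∷reverse w =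
    ≡-trans (QP.*-identityˡ _) (QP.*-assoc (powℚ (1ℚ - h) b) (powℚ h (inversions w)) (revScanProb dash (reverse w) (reverse (padTo (suc N) σ))))
  ... | false with revScanProb≡0⊎↭ dash (reverse w) (reverse (padTo (suc N) σ))
  ...   | inj₁ z rewrite z =
    solve 4 (λ c P T W → con 0ℚ :* (P :* T) := c :* (W :* con 0ℚ)) refl
      (powℚ (1ℚ - h) b) (piDist h b (trim w)) (trans h (trim w) σ) (weight (dash ∷ reverse w))
    where open +-*-Solver
  ...   | inj₂ p with ≡-trans (sym valid-w) (≡-trans (sym (validB-reverse b w)) (≡-trans (validB-↭ b p) (validB-reverse-padTo b (suc N) σ valid-σ)))
  ...     | ()

  stationarity-defect : ∀ b N σ → 1 ≤ b → validB b σ ≡ true → trim σ ≡ σ → length σ ≤ suc N →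
    sumℚ (map (λ τ → piDist h b τ * trans h τ σ) (statesIn b N))
      ≡ powℚ (1ℚ - h) b * (powℚ h (inversions σ) - ballStartMass b N (reverse (padTo (suc N) σ)))
  stationarity-defect b N σ 1≤b valid-σ trim-σ σ-fits = begin
      sumℚ (map (λ τ → piDist h b τ * trans h τ σ) (statesIn b N))
    ≡⟨ sum-statesIn b N (λ τ → piDist h b τ * trans h τ σ) ⟩
      sumL (allWords b N) (λ w → 𝟙 (validB b w) * (piDist h b (trim w) * trans h (trim w) σ))
    ≡⟨ sumWords-cong b N (λ w → flowTerm≡dashScan b N σ w 1≤b valid-σ trim-σ) ⟩
      sumL (allWords b N) (λ w → C * dashTerm (reverse w))
    ≡⟨ sumWords-reverse b N (λ r → C * dashTerm r) ⟩
      sumL (allWords b N) (λ r → C * dashTerm r)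
    ≡⟨ sumL-*ˡ (allWords b N) C dashTerm ⟩
      C * sumL (allWords b N) dashTerm
    ≡⟨ cong (C *_) (solve 2 (λ A E → A := A :+ E :- E) refl (sumL (allWords b N) dashTerm) (ballStartMass b N t)) ⟩
      C * (sumL (allWords b N) dashTerm + ballStartMass b N t - ballStartMass b N t)
    ≡⟨ cong (λ z → C * (z - ballStartMass b N t)) (≡-trans (sym (sumL-+ (allWords b N) dashTerm ballTerm)) balance) ⟩
      C * (weight t - ballStartMass b N t)
    ≡⟨ cong (λ n → C * (powℚ h n - ballStartMass b N t)) revInversions-t ⟩
      C * (powℚ h (inversions σ) - ballStartMass b N t)
    ∎
    where
    open ≡-Reasoning
    open +-*-Solver
    C = powℚ (1ℚ - h) b
    t = reverse (padTo (suc N) σ)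
    dashTerm ballTerm : Word → ℚ
    dashTerm r = weight (dash ∷ r) * revScanProb dash r t
    ballTerm r = sumL (map num (upTo1 b)) (λ x → weight (x ∷ r) * revScanProb x r t)
    valid-t : validB b t ≡ true
    valid-t = validB-reverse-padTo b (suc N) σ valid-σ
    length-t : length t ≡ suc N
    length-t = ≡-trans (LP.length-reverse (padTo (suc N) σ)) (length-padTo (suc N) σ σ-fits)
    balance : sumL (allWords b N) (λ r → dashTerm r + ballTerm r) ≡ weight t
    balance = revScanProb-balance b N t length-t
      (allB⇒All t (∧-elimˡ {allB (inRange b) t} valid-t) (count-letters b))
    revInversions-t : revInversions t ≡ inversions σ
    revInversions-t = ≡-trans (revInversions≡inversions-reverse t)
      (≡-trans (cong inversions (LP.reverse-involutive (padTo (suc N) σ))) (inversions-padDashes σ _))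

  -- Weight of the states that have a ball at the last position N of the window [0, N + 1).
  topMass : ℕ → ℕ → ℚ
  topMass b N = sumL (allWords b N) (λ r → sumL (map num (upTo1 b)) (λ x → 𝟙 (validB b (x ∷ r)) * weight (x ∷ r)))

  partitionSum-reverse : ∀ b N → partitionSum b N ≡ sumL (allWords b N) (λ s → 𝟙 (validB b s) * weight s)
  partitionSum-reverse b N = ≡-trans (sym (sumWords-reverse b N (validWeight b)))
    (sumL-cong (allWords b N) (λ s → cong₂ (λ A n → 𝟙 A * powℚ h n) (validB-reverse b s) (sym (revInversions≡inversions-reverse s))))

  partitionSum-extend : ∀ b N → partitionSum b (suc N) ≡ partitionSum b N + topMass b N
  partitionSum-extend b N = begin
      partitionSum b (suc N)
    ≡⟨ partitionSum-reverse b (suc N) ⟩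
      sumL (allWords b (suc N)) (λ s → 𝟙 (validB b s) * weight s)
    ≡⟨ sumWords-∷ b N (λ s → 𝟙 (validB b s) * weight s) ⟩
      sumL (allWords b N) (λ r → 𝟙 (validB b (dash ∷ r)) * weight (dash ∷ r) + ballTerm r)
    ≡⟨ sumL-+ (allWords b N) (λ r → 𝟙 (validB b (dash ∷ r)) * weight (dash ∷ r)) ballTerm ⟩
      sumL (allWords b N) (λ r → 𝟙 (validB b r) * weight (dash ∷ r)) + topMass b N
    ≡⟨ cong (_+ topMass b N) (sumL-cong (allWords b N) (λ r → cong (λ n → 𝟙 (validB b r) * powℚ h n)
                                                         (≡-trans (cong (revInversions r N.+_) (countAbove-dash r)) (NP.+-identityʳ _)))) ⟩
      sumL (allWords b N) (λ r → 𝟙 (validB b r) * weight r) + topMass b N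
    ≡⟨ cong (_+ topMass b N) (sym (partitionSum-reverse b N)) ⟩
      partitionSum b N + topMass b N
    ∎
    where
    open ≡-Reasoning
    ballTerm : Word → ℚ
    ballTerm r = sumL (map num (upTo1 b)) (λ x → 𝟙 (validB b (x ∷ r)) * weight (x ∷ r))

  normalisedProduct : ℕ → ℕ → ℚ
  normalisedProduct zero N = 1ℚ
  normalisedProduct (suc b) N = (1ℚ - powℚ h (N N.∸ b)) * normalisedProduct b N

  geomSum-closed : ∀ m → (1ℚ - h) * geomSum m ≡ 1ℚ - powℚ h m
  geomSum-closed zero = ≡-trans (QP.*-zeroʳ (1ℚ - h)) (sym (QP.+-inverseʳ 1ℚ))
  geomSum-closed (suc m) =
    ≡-trans (solve 2 (λ h g → (con 1ℚ :- h) :* (con 1ℚ :+ h :* g) := (con 1ℚ :- h) :+ h :* ((con 1ℚ :- h) :* g)) refl h (geomSum m))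
    (≡-trans (cong (λ z → (1ℚ - h) + h * z) (geomSum-closed m))
    (solve 2 (λ h p → (con 1ℚ :- h) :+ h :* (con 1ℚ :- p) := con 1ℚ :- h :* p) refl h (powℚ h m)))
    where open +-*-Solver

  partitionSum-normalised : ∀ b N → powℚ (1ℚ - h) b * partitionSum b N ≡ normalisedProduct b N
  partitionSum-normalised b N = ≡-trans (cong (powℚ (1ℚ - h) b *_) (partitionSum≡partitionProduct b N)) (rescale b)
    where
    open +-*-Solver
    rescale : ∀ b → powℚ (1ℚ - h) b * partitionProduct b N ≡ normalisedProduct b N
    rescale zero = QP.*-identityˡ 1ℚ
    rescale (suc b) =
      ≡-trans (solve 4 (λ a c g p → a :* c :* (g :* p) := a :* g :* (c :* p)) refl (1ℚ - h) (powℚ (1ℚ - h) b) (geomSum (N N.∸ b)) (partitionProduct b N))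
      (cong₂ _*_ (geomSum-closed (N N.∸ b)) (rescale b))

  statesMass≡normalisedProduct : ∀ b N → sumℚ (map (piDist h b) (statesIn b N)) ≡ normalisedProduct b N
  statesMass≡normalisedProduct b N =
    ≡-trans (sum-statesIn b N (piDist h b))
    (≡-trans (sumL-cong (allWords b N) (λ w → ≡-trans (cong (λ n → 𝟙 (validB b w) * (powℚ (1ℚ - h) b * powℚ h n)) (inversions-trim w))
                                                      (commute (𝟙 (validB b w)) (powℚ (1ℚ - h) b) (powℚ h (inversions w)))))
    (≡-trans (sumL-*ˡ (allWords b N) (powℚ (1ℚ - h) b) (validWeight b)) (partitionSum-normalised b N)))
    where
    open +-*-Solver
    commute : ∀ v c x → v * (c * x) ≡ c * (v * x)
    commute = solve 3 (λ v c x → v :* (c :* x) := c :* (v :* x)) refl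

  topMass-normalised : ∀ b N → powℚ (1ℚ - h) b * topMass b N ≡ normalisedProduct b (suc N) - normalisedProduct b N
  topMass-normalised b N = ≡-trans (cong (C *_) (solve 2 (λ Z D → D := Z :+ D :- Z) refl (partitionSum b N) (topMass b N)))
    (≡-trans (cong (λ z → C * (z - partitionSum b N)) (sym (partitionSum-extend b N)))
    (≡-trans (solve 3 (λ c A B → c :* (A :- B) := c :* A :- c :* B) refl C (partitionSum b (suc N)) (partitionSum b N))
    (cong₂ _-_ (partitionSum-normalised b (suc N)) (partitionSum-normalised b N))))
    where
    open +-*-Solver
    C = powℚ (1ℚ - h) b

-- Estimates for 0 ≤ h ≤ 1

*-monoˡ-≤ : ∀ {p q r} → 0ℚ ≤q r → p ≤q q → r * p ≤q r * q
*-monoˡ-≤ {r = r} 0≤r le = QP.*-monoˡ-≤-nonNeg r {{Q.nonNegative 0≤r}} le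

*-monoʳ-≤ : ∀ {p q r} → 0ℚ ≤q r → p ≤q q → p * r ≤q q * r
*-monoʳ-≤ {r = r} 0≤r le = QP.*-monoʳ-≤-nonNeg r {{Q.nonNegative 0≤r}} le

*-nonNeg : ∀ {a b} → 0ℚ ≤q a → 0ℚ ≤q b → 0ℚ ≤q a * b
*-nonNeg {a} {b} 0≤a 0≤b = QP.≤-trans (QP.≤-reflexive (sym (QP.*-zeroˡ b))) (*-monoʳ-≤ 0≤b 0≤a)

≤⇒0≤- : ∀ {p q} → p ≤q q → 0ℚ ≤q q - p
≤⇒0≤- {p} le = QP.≤-trans (QP.≤-reflexive (sym (QP.+-inverseʳ p))) (QP.+-monoˡ-≤ (- p) le)

0≤-⇒≤ : ∀ {p q} → 0ℚ ≤q q - p → p ≤q q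
0≤-⇒≤ {p} {q} 0≤q-p = QP.≤-trans (QP.≤-reflexive (sym (QP.+-identityˡ p)))
  (QP.≤-trans (QP.+-monoˡ-≤ p 0≤q-p) (QP.≤-reflexive (solve 2 (λ p q → q :- p :+ p := q) refl p q)))
  where open +-*-Solver

0≤1 : 0ℚ ≤q 1ℚ
0≤1 = QP.<⇒≤ (QP.positive⁻¹ 1ℚ)

InUnit : ℚ → Set
InUnit z = (0ℚ ≤q z) × (z ≤q 1ℚ)

InUnit-0 : InUnit 0ℚ
InUnit-0 = QP.≤-refl , 0≤1

InUnit-1 : InUnit 1ℚ
InUnit-1 = 0≤1 , QP.≤-refl

InUnit-* : ∀ {a b} → InUnit a → InUnit b → InUnit (a * b)
InUnit-* {a} {b} (0≤a , a≤1) (0≤b , b≤1) = *-nonNeg 0≤a 0≤b , QP.≤-trans (*-monoʳ-≤ 0≤b a≤1) (QP.≤-trans (QP.≤-reflexive (QP.*-identityˡ b)) b≤1)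

InUnit-1- : ∀ {a} → InUnit a → InUnit (1ℚ - a)
InUnit-1- {a} (0≤a , a≤1) = ≤⇒0≤- a≤1 , 0≤-⇒≤ (QP.≤-trans 0≤a (QP.≤-reflexive (solve 1 (λ a → a := con 1ℚ :- (con 1ℚ :- a)) refl a)))
  where open +-*-Solver

InUnit-𝟙 : ∀ c → InUnit (𝟙 c)
InUnit-𝟙 true = InUnit-1
InUnit-𝟙 false = InUnit-0

ℕtoℚ : ℕ → ℚ
ℕtoℚ zero = 0ℚ
ℕtoℚ (suc n) = 1ℚ + ℕtoℚ n

ℕtoℚ-nonNeg : ∀ n → 0ℚ ≤q ℕtoℚ n
ℕtoℚ-nonNeg zero = QP.≤-refl
ℕtoℚ-nonNeg (suc n) = QP.+-mono-≤ 0≤1 (ℕtoℚ-nonNeg n)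

module _ (h : ℚ) (h∈ : InUnit h) where

  powℚ-inUnit : ∀ n → InUnit (powℚ h n)
  powℚ-inUnit zero = InUnit-1
  powℚ-inUnit (suc n) = InUnit-* h∈ (powℚ-inUnit n)

  powℚ-antitone : ∀ {m n} → m ≤ n → powℚ h n ≤q powℚ h m
  powℚ-antitone {m} m≤n with NP.m≤n⇒∃[o]m+o≡n m≤n
  ... | o , refl rewrite powℚ-+ h m o =
    QP.≤-trans (*-monoˡ-≤ (proj₁ (powℚ-inUnit m)) (proj₂ (powℚ-inUnit o))) (QP.≤-reflexive (QP.*-identityʳ (powℚ h m)))

  keepProb-inUnit : ∀ e x → InUnit (keepProb h e x)
  keepProb-inUnit e x with ltE e x
  ... | true = h∈
  ... | false = InUnit-1

  swapProb-inUnit : ∀ e x → InUnit (swapProb h e x)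
  swapProb-inUnit e x with ltE e x
  ... | true = InUnit-1- h∈
  ... | false = InUnit-0

  revScanProb-inUnit : ∀ x r t → InUnit (revScanProb h x r t)
  revScanProb-inUnit x [] [] = InUnit-0
  revScanProb-inUnit x [] (c ∷ []) = InUnit-𝟙 (does (x ≟E c))
  revScanProb-inUnit x [] (c ∷ d ∷ t) = InUnit-0
  revScanProb-inUnit x (e ∷ r) [] = InUnit-0
  revScanProb-inUnit x (e ∷ r) (c ∷ t) with e ≟E c | x ≟E c
  ... | no _ | no _ = subst InUnit (sym (neither-selected (keepProb h e x) (swapProb h e x) (revScanProb h x r t) (revScanProb h e r t))) InUnit-0
  ... | yes refl | no _ = subst InUnit (sym (first-selected (keepProb h e x) (swapProb h e x) (revScanProb h x r t) (revScanProb h e r t)))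
      (InUnit-* (keepProb-inUnit e x) (revScanProb-inUnit x r t))
  ... | no _ | yes refl = subst InUnit (sym (second-selected (keepProb h e x) (swapProb h e x) (revScanProb h x r t) (revScanProb h e r t)))
      (InUnit-* (swapProb-inUnit e x) (revScanProb-inUnit e r t))
  ... | yes refl | yes refl rewrite ltE-irrefl x =
      subst InUnit (sym (both-selected-kept (revScanProb h x r t))) (revScanProb-inUnit x r t)

  revScanProb≤𝟙validB : ∀ b x r t → validB b t ≡ true → revScanProb h x r t ≤q 𝟙 (validB b (x ∷ r))
  revScanProb≤𝟙validB b x r t valid-t with revScanProb≡0⊎↭ h x r t
  ... | inj₁ z = QP.≤-trans (QP.≤-reflexive z) (proj₁ (InUnit-𝟙 (validB b (x ∷ r))))
  ... | inj₂ p rewrite validB-↭ b p | valid-t = proj₂ (revScanProb-inUnit x r t)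

  ballStartMass-nonNeg : ∀ b N t → 0ℚ ≤q ballStartMass h b N t
  ballStartMass-nonNeg b N t = sumL-nonNeg (allWords b N) (λ r → sumL-nonNeg (map num (upTo1 b)) (λ x →
    *-nonNeg (proj₁ (powℚ-inUnit (revInversions (x ∷ r)))) (proj₁ (revScanProb-inUnit x r t))))

  ballStartMass≤topMass : ∀ b N t → validB b t ≡ true → ballStartMass h b N t ≤q topMass h b N
  ballStartMass≤topMass b N t valid-t = sumL-mono (allWords b N) (λ r → sumL-mono (map num (upTo1 b)) (λ x →
    QP.≤-trans (*-monoˡ-≤ (proj₁ (powℚ-inUnit (revInversions (x ∷ r)))) (revScanProb≤𝟙validB b x r t valid-t))
               (QP.≤-reflexive (QP.*-comm (weight h (x ∷ r)) (𝟙 (validB b (x ∷ r)))))))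

  normalisedProduct-inUnit : ∀ b N → InUnit (normalisedProduct h b N)
  normalisedProduct-inUnit zero N = InUnit-1
  normalisedProduct-inUnit (suc b) N = InUnit-* (InUnit-1- (powℚ-inUnit (N N.∸ b))) (normalisedProduct-inUnit b N)

  1-normalisedProduct≤ : ∀ b N → 1ℚ - normalisedProduct h b N ≤q ℕtoℚ b * powℚ h (N N.∸ b)
  1-normalisedProduct≤ zero N = QP.≤-trans (QP.≤-reflexive (QP.+-inverseʳ 1ℚ)) (QP.≤-reflexive (sym (QP.*-zeroˡ (powℚ h N))))
  1-normalisedProduct≤ (suc b) N =
    QP.≤-trans (QP.≤-reflexive (solve 2 (λ x Q → con 1ℚ :- (con 1ℚ :- x) :* Q := (con 1ℚ :- Q) :+ x :* Q) refl x Q))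
    (QP.≤-trans (QP.+-mono-≤ (1-normalisedProduct≤ b N) xQ≤x)
    (QP.≤-trans (QP.+-mono-≤ (*-monoˡ-≤ (ℕtoℚ-nonNeg b) x≤y) x≤y)
    (QP.≤-reflexive (solve 2 (λ n y → n :* y :+ y := (con 1ℚ :+ n) :* y) refl (ℕtoℚ b) y))))
    where
    open +-*-Solver
    x = powℚ h (N N.∸ b)
    y = powℚ h (N N.∸ suc b)
    Q = normalisedProduct h b N
    xQ≤x : x * Q ≤q x
    xQ≤x = QP.≤-trans (*-monoˡ-≤ (proj₁ (powℚ-inUnit (N N.∸ b))) (proj₂ (normalisedProduct-inUnit b N))) (QP.≤-reflexive (QP.*-identityʳ x))
    x≤y : x ≤q y
    x≤y = powℚ-antitone (NP.∸-monoʳ-≤ N (NP.n≤1+n b))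

  1-normalisedProduct-window : ∀ b m N → m N.+ b ≤ N → 1ℚ - normalisedProduct h b N ≤q ℕtoℚ b * powℚ h m
  1-normalisedProduct-window b m N m+b≤N = QP.≤-trans (1-normalisedProduct≤ b N)
    (*-monoˡ-≤ (ℕtoℚ-nonNeg b) (powℚ-antitone (NP.≤-trans (NP.≤-reflexive (sym (NP.m+n∸n≡m m b))) (NP.∸-monoˡ-≤ b m+b≤N))))

  statesMass-gap : ∀ b m N → m N.+ b ≤ N → Q.∣ sumℚ (map (piDist h b) (statesIn b N)) - 1ℚ ∣ ≤q ℕtoℚ b * powℚ h m
  statesMass-gap b m N m+b≤N = QP.≤-trans
    (QP.≤-reflexive (≡-trans (cong (λ z → Q.∣ z - 1ℚ ∣) (statesMass≡normalisedProduct h b N)) (∣z-1∣ (normalisedProduct-inUnit b N))))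
    (1-normalisedProduct-window b m N m+b≤N)
    where
    ∣z-1∣ : ∀ {z} → InUnit z → Q.∣ z - 1ℚ ∣ ≡ 1ℚ - z
    ∣z-1∣ {z} (_ , z≤1) = ≡-trans (cong Q.∣_∣ (solve 1 (λ z → z :- con 1ℚ := :- (con 1ℚ :- z)) refl z))
      (≡-trans (QP.∣-p∣≡∣p∣ (1ℚ - z)) (QP.0≤p⇒∣p∣≡p (≤⇒0≤- z≤1)))
      where open +-*-Solver

  stationarity-gap : ∀ b σ m N → 1 ≤ b → IsState b σ → m N.+ (b N.+ length σ) ≤ N →
    Q.∣ sumℚ (map (λ τ → piDist h b τ * trans h τ σ) (statesIn b N)) - piDist h b σ ∣ ≤q ℕtoℚ b * powℚ h m
  stationarity-gap b σ m N 1≤b (valid-σ , trim-σ) le = begin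
      Q.∣ sumℚ (map (λ τ → piDist h b τ * trans h τ σ) (statesIn b N)) - piDist h b σ ∣
    ≡⟨ cong (λ z → Q.∣ z - piDist h b σ ∣) (stationarity-defect h b N σ 1≤b valid-σ trim-σ σ-fits) ⟩
      Q.∣ C * (powℚ h (inversions σ) - E) - C * powℚ h (inversions σ) ∣
    ≡⟨ cong Q.∣_∣ (solve 3 (λ C H E → C :* (H :- E) :- C :* H := :- (C :* E)) refl C (powℚ h (inversions σ)) E) ⟩
      Q.∣ - (C * E) ∣
    ≡⟨ ≡-trans (QP.∣-p∣≡∣p∣ (C * E)) (QP.0≤p⇒∣p∣≡p (*-nonNeg (proj₁ C∈) (ballStartMass-nonNeg b N t))) ⟩
      C * E
    ≤⟨ *-monoˡ-≤ (proj₁ C∈) (ballStartMass≤topMass b N t valid-t) ⟩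
      C * topMass h b N
    ≡⟨ topMass-normalised h b N ⟩
      normalisedProduct h b (suc N) - normalisedProduct h b N
    ≤⟨ QP.+-monoˡ-≤ (- normalisedProduct h b N) (proj₂ (normalisedProduct-inUnit b (suc N))) ⟩
      1ℚ - normalisedProduct h b N
    ≤⟨ 1-normalisedProduct-window b m N (NP.≤-trans (NP.+-monoʳ-≤ m (NP.m≤m+n b (length σ))) le) ⟩
      ℕtoℚ b * powℚ h m
    ∎
    where
    open QP.≤-Reasoning
    open +-*-Solver
    C = powℚ (1ℚ - h) b
    t = reverse (padTo (suc N) σ)
    E = ballStartMass h b N t
    C∈ : InUnit C
    C∈ = powℚ-inUnit′ b
      where
      powℚ-inUnit′ : ∀ n → InUnit (powℚ (1ℚ - h) n)
      powℚ-inUnit′ zero = InUnit-1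
      powℚ-inUnit′ (suc n) = InUnit-* (InUnit-1- h∈) (powℚ-inUnit′ n)
    σ-fits : length σ ≤ suc N
    σ-fits = NP.m≤n⇒m≤1+n (NP.≤-trans (NP.≤-trans (NP.m≤n+m (length σ) b) (NP.m≤n+m (b N.+ length σ) m)) le)
    valid-t : validB b t ≡ true
    valid-t = validB-reverse-padTo b (suc N) σ valid-σ

-- Limits

ℕtoℚ≡mkℚ : ∀ n → ℕtoℚ n ≡ mkℚ (ℤ+ n) 0 (Cop.sym (Cop.1-coprimeTo n))
ℕtoℚ≡mkℚ zero = refl
ℕtoℚ≡mkℚ (suc n) rewrite ℕtoℚ≡mkℚ n =
  ≡-trans (cong (Q._/ 1) (cong (λ z → ℤ+ 1 ℤ.+ z) (ZP.*-identityʳ (ℤ+ n)))) (QP.↥p/↧p≡p (mkℚ (ℤ+ suc n) 0 (Cop.sym (Cop.1-coprimeTo (suc n)))))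

ℕtoℚ-* : ∀ m n → ℕtoℚ (m N.* n) ≡ ℕtoℚ m * ℕtoℚ n
ℕtoℚ-* zero n = sym (QP.*-zeroˡ (ℕtoℚ n))
ℕtoℚ-* (suc m) n = ≡-trans (ℕtoℚ-+ n (m N.* n)) (≡-trans (cong (ℕtoℚ n +_) (ℕtoℚ-* m n))
  (solve 2 (λ a b → a :+ b :* a := (con 1ℚ :+ b) :* a) refl (ℕtoℚ n) (ℕtoℚ m)))
  where
  open +-*-Solver
  ℕtoℚ-+ : ∀ m n → ℕtoℚ (m N.+ n) ≡ ℕtoℚ m + ℕtoℚ n
  ℕtoℚ-+ zero n = sym (QP.+-identityˡ _)
  ℕtoℚ-+ (suc m) n = ≡-trans (cong (1ℚ +_) (ℕtoℚ-+ m n)) (sym (QP.+-assoc 1ℚ (ℕtoℚ m) (ℕtoℚ n)))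

-- For δ = (1 + n)/d in lowest terms, K = d + 1 already satisfies 1 ≤ K δ.
archimedean : ∀ δ → 0ℚ < δ → Σ ℕ (λ K → 1ℚ ≤q ℕtoℚ K * δ)
archimedean (mkℚ (ℤ+ zero) d c) (*<* (ℤ.+<+ ()))
archimedean δ@(mkℚ +[1+ n ] d c) 0<δ =
  suc d , subst (λ z → 1ℚ ≤q z * δ) (sym (ℕtoℚ≡mkℚ (suc d)))
    (QP.≤-trans (QP.≤-reflexive (sym (QP.*-inverseʳ δ)))
    (QP.≤-trans (QP.*-monoˡ-≤-nonNeg δ {{Q.nonNegative (QP.<⇒≤ 0<δ)}} 1/δ≤)
    (QP.≤-reflexive (QP.*-comm δ (mkℚ (ℤ+ suc d) 0 (Cop.sym (Cop.1-coprimeTo (suc d))))))))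
  where
  1/δ≤ : (1/ δ) ≤q mkℚ (ℤ+ suc d) 0 (Cop.sym (Cop.1-coprimeTo (suc d)))
  1/δ≤ = *≤* (ZP.≤-trans (ZP.≤-reflexive (ZP.*-identityʳ +[1+ d ]))
               (ZP.≤-trans (ZP.≤-reflexive (sym (ZP.*-identityʳ (ℤ+ suc d)))) (ZP.*-monoˡ-≤-nonNeg (ℤ+ suc d) (ℤ.+≤+ (s≤s z≤n)))))

bernoulli : ∀ d → 0ℚ ≤q d → ∀ M → 1ℚ + ℕtoℚ M * d ≤q powℚ (1ℚ + d) M
bernoulli d 0≤d zero = QP.≤-reflexive (≡-trans (cong (1ℚ +_) (QP.*-zeroˡ d)) (QP.+-identityʳ 1ℚ))
bernoulli d 0≤d (suc M) =
  QP.≤-trans (0≤-⇒≤ (QP.≤-trans (*-nonNeg (*-nonNeg (ℕtoℚ-nonNeg M) 0≤d) 0≤d) (QP.≤-reflexive (step (ℕtoℚ M) d))))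
             (*-monoˡ-≤ (QP.+-mono-≤ 0≤1 0≤d) (bernoulli d 0≤d M))
  where
  open +-*-Solver
  step : ∀ m d → m * d * d ≡ (1ℚ + d) * (1ℚ + m * d) - (1ℚ + (1ℚ + m) * d)
  step = solve 2 (λ m d → m :* d :* d := (con 1ℚ :+ d) :* (con 1ℚ :+ m :* d) :- (con 1ℚ :+ (con 1ℚ :+ m) :* d)) refl

powℚ-*-distrib : ∀ a c n → powℚ a n * powℚ c n ≡ powℚ (a * c) n
powℚ-*-distrib a c zero = QP.*-identityˡ 1ℚ
powℚ-*-distrib a c (suc n) =
  ≡-trans (solve 4 (λ a c x y → a :* x :* (c :* y) := a :* c :* (x :* y)) refl a c (powℚ a n) (powℚ c n))
          (cong ((a * c) *_) (powℚ-*-distrib a c n))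
  where open +-*-Solver

powℚ-1 : ∀ n → powℚ 1ℚ n ≡ 1ℚ
powℚ-1 zero = refl
powℚ-1 (suc n) = ≡-trans (cong (1ℚ *_) (powℚ-1 n)) (QP.*-identityˡ 1ℚ)

*-pos : ∀ {a b} → 0ℚ < a → 0ℚ < b → 0ℚ < a * b
*-pos {a} {b} 0<a 0<b = QP.≤-<-trans (QP.≤-reflexive (sym (QP.*-zeroˡ b))) (QP.*-monoˡ-<-pos b {{Q.positive 0<b}} 0<a)

module _ (q : ℚ) .{{_ : NonZero q}} (1<q : 1ℚ < q) where

  private
    0<q : 0ℚ < q
    0<q = QP.<-trans (QP.positive⁻¹ 1ℚ) 1<q

    0<q-1 : 0ℚ < q - 1ℚ
    0<q-1 = QP.≤-<-trans (QP.≤-reflexive (sym (QP.+-inverseʳ 1ℚ))) (QP.+-monoˡ-< (- 1ℚ) 1<q)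

    0<1/q : 0ℚ < 1/ q
    0<1/q = QP.positive⁻¹ _ {{QP.1/pos⇒pos q {{Q.positive 0<q}}}}

  1/q-inUnit : InUnit (1/ q)
  1/q-inUnit = QP.<⇒≤ 0<1/q , QP.≤-trans (QP.≤-reflexive (sym (QP.*-identityʳ (1/ q))))
    (QP.≤-trans (*-monoˡ-≤ (QP.<⇒≤ 0<1/q) (QP.<⇒≤ 1<q)) (QP.≤-reflexive (QP.*-inverseˡ q)))

  -- Bernoulli's inequality q^M ≥ 1 + M (q − 1) makes c q^{-M} small as soon as M (q − 1) ε ≥ c.
  ℕtoℚ*powℚ-small : ∀ c ε → 0ℚ < ε → Σ ℕ (λ M → ℕtoℚ c * powℚ (1/ q) M < ε)
  ℕtoℚ*powℚ-small c ε 0<ε with archimedean (ε * (q - 1ℚ)) (*-pos 0<ε 0<q-1)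
  ... | K , 1≤Kεd = M , (begin-strict
      ℕtoℚ c * powℚ (1/ q) M
    <⟨ QP.*-monoˡ-<-pos (powℚ (1/ q) M) {{Q.positive (powℚ-pos M)}} c<εq^M ⟩
      ε * powℚ q M * powℚ (1/ q) M
    ≡⟨ QP.*-assoc ε (powℚ q M) (powℚ (1/ q) M) ⟩
      ε * (powℚ q M * powℚ (1/ q) M)
    ≡⟨ cong (ε *_) (≡-trans (powℚ-*-distrib q (1/ q) M) (≡-trans (cong (λ z → powℚ z M) (QP.*-inverseʳ q)) (powℚ-1 M))) ⟩
      ε * 1ℚ
    ≡⟨ QP.*-identityʳ ε ⟩
      ε
    ∎)
    where
    open QP.≤-Reasoning
    open +-*-Solver
    M = c N.* K
    d = q - 1ℚ
    powℚ-pos : ∀ n → 0ℚ < powℚ (1/ q) n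
    powℚ-pos zero = QP.positive⁻¹ 1ℚ
    powℚ-pos (suc n) = *-pos 0<1/q (powℚ-pos n)
    c<εq^M : ℕtoℚ c < ε * powℚ q M
    c<εq^M = begin-strict
        ℕtoℚ c
      ≡⟨ sym (QP.*-identityʳ (ℕtoℚ c)) ⟩
        ℕtoℚ c * 1ℚ
      ≤⟨ *-monoˡ-≤ (ℕtoℚ-nonNeg c) 1≤Kεd ⟩
        ℕtoℚ c * (ℕtoℚ K * (ε * d))
      ≡⟨ ≡-trans (sym (QP.*-assoc (ℕtoℚ c) (ℕtoℚ K) (ε * d))) (cong (_* (ε * d)) (sym (ℕtoℚ-* c K))) ⟩
        ℕtoℚ M * (ε * d)
      ≡⟨ solve 3 (λ m e d → m :* (e :* d) := e :* (con 0ℚ :+ m :* d)) refl (ℕtoℚ M) ε d ⟩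
        ε * (0ℚ + ℕtoℚ M * d)
      <⟨ QP.*-monoʳ-<-pos ε {{Q.positive 0<ε}} (QP.+-monoˡ-< (ℕtoℚ M * d) (QP.positive⁻¹ 1ℚ)) ⟩
        ε * (1ℚ + ℕtoℚ M * d)
      ≤⟨ *-monoˡ-≤ (QP.<⇒≤ 0<ε) (subst (λ z → 1ℚ + ℕtoℚ M * d ≤q powℚ z M) (solve 1 (λ q → con 1ℚ :+ (q :- con 1ℚ) := q) refl q)
                                      (bernoulli d (QP.<⇒≤ 0<q-1) M)) ⟩
        ε * powℚ q M
      ∎

converges-fromBound : ∀ (s : ℕ → ℚ) L (B : ℕ → ℚ) k → (∀ m N → m N.+ k ≤ N → Q.∣ s N - L ∣ ≤q B m) →
  (∀ ε → 0ℚ < ε → Σ ℕ (λ M → B M < ε)) → Converges s L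
converges-fromBound s L B k bound small ε 0<ε with small ε 0<ε
... | M , BM<ε = M N.+ k , λ N le → QP.≤-<-trans (bound M N le) BM<ε

theorem4p4 : (q : ℚ) .{{_ : NonZero q}} → 1ℚ < q → (b : ℕ) → 1 ≤ b →
    Converges (λ N → sumℚ (map (piDist (1/ q) b) (statesIn b N))) 1ℚ
    × (∀ (σ : Word) → IsState b σ →
        Converges (λ N → sumℚ (map (λ τ → piDist (1/ q) b τ * trans (1/ q) τ σ) (statesIn b N)))
                  (piDist (1/ q) b σ))
theorem4p4 q 1<q b 1≤b =
  converges-fromBound mass 1ℚ bound b (statesMass-gap h h∈ b) small ,
  λ σ σ-state → converges-fromBound (flowInto σ) (piDist h b σ) bound (b N.+ length σ)
                  (λ m N → stationarity-gap h h∈ b σ m N 1≤b σ-state) small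
  where
  h : ℚ
  h = 1/ q
  h∈ : InUnit h
  h∈ = 1/q-inUnit q 1<q
  mass : ℕ → ℚ
  mass N = sumℚ (map (piDist h b) (statesIn b N))
  flowInto : Word → ℕ → ℚ
  flowInto σ N = sumℚ (map (λ τ → piDist h b τ * trans h τ σ) (statesIn b N))
  bound : ℕ → ℚ
  bound m = ℕtoℚ b * powℚ h m
  small : ∀ ε → 0ℚ < ε → Σ ℕ (λ M → bound M < ε)
  small = ℕtoℚ*powℚ-small q 1<q b
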